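{- Let $G$ be a finite simple graph such that $Y_G\in\Gamma$. Then $G$ has no pair of disjoint edges. Furthermore, if $G$ is connected, then $G$ is either the triangle $C_3$ or the star graph $S_n$ for some $n\ge1$.
   Context: For a finite simple graph $G$, $X_G=\sum_{\kappa}\prod_{v}x_{\kappa(v)}$ is its chromatic symmetric function (sum over proper colorings $\kappa:V\to\{1,2,\dots\}$), $\omega$ is the involution of the algebra of symmetric functions with $\omega(p_r)=(-1)^{r-1}p_r$ where $p_r=\sum_ix_i^r$, and $Y_G=(X_G+\omega(X_G))/2$ is the near chromatic symmetric function. $\Gamma=\mathbb{Q}[p_1,p_3,p_5,\dots]$. Two edges $\{v_1,v_2\}$ and $\{v_3,v_4\}$ are disjoint if $v_1,v_2,v_3,v_4$ are all distinct. $C_3$ is the cycle on three vertices; $S_n$ is the tree with one internal vertex and $n-1$ leaves ($S_1$ a single vertex). -}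

module Defs where

open import Data.Bool using (Bool; true; false; _∧_; _∨_; not; if_then_else_)
open import Data.Nat as ℕ using (ℕ; zero; suc; _≡ᵇ_)
open import Data.Fin as Fin using (Fin)
open import Data.Fin.Properties using (_≟_)
open import Data.List as List using (List; []; _∷_; length; map; concatMap; allFin; foldr; filterᵇ)
open import Data.Nat.ListAction using () renaming (sum to sumℕ)
open import Data.Vec as Vec using (Vec; []; _∷_; lookup; toList)
open import Data.Product using (Σ; ∃; ∃-syntax; _×_; _,_; proj₁; proj₂)
open import Data.Sum using (_⊎_)
open import Data.Empty using (⊥)
open import Data.Integer using (+_)
open import Data.Rational as ℚ using (ℚ; 0ℚ; 1ℚ; ½; _/_)
open import Relation.Nullary using (¬_; does)
open import Relation.Binary.PropositionalEquality using (_≡_; _≢_)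
open import Function.Bundles using (_↔_; Inverse)

record Graph : Set where
  field
    n     : ℕ
    adj   : Fin n → Fin n → Bool
    sym   : ∀ u v → adj u v ≡ adj v u
    irrefl : ∀ v → adj v v ≡ false
open Graph public

HasDisjointEdges : Graph → Set
HasDisjointEdges G =
  ∃[ v1 ] ∃[ v2 ] ∃[ v3 ] ∃[ v4 ]
    (adj G v1 v2 ≡ true × adj G v3 v4 ≡ true ×
     v1 ≢ v2 × v1 ≢ v3 × v1 ≢ v4 × v2 ≢ v3 × v2 ≢ v4 × v3 ≢ v4)

-- walks and connectedness (a connected graph is nonempty)
data Walk (G : Graph) : Fin (n G) → Fin (n G) → Set where
  here : ∀ {u} → Walk G u u
  step : ∀ {u v w} → adj G u v ≡ true → Walk G v w → Walk G u w

Connected : Graph → Set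
Connected G = Fin (n G) × (∀ u v → Walk G u v)

_≅_ : Graph → Graph → Set
G ≅ H = Σ (Fin (n G) ↔ Fin (n H)) λ φ →
          ∀ u v → adj G u v ≡ adj H (Inverse.to φ u) (Inverse.to φ v)

C3 : Graph
C3 = record { n = 3 ; adj = λ u v → not (does (u ≟ v))
            ; sym = s ; irrefl = r }
  where
  s : ∀ (u v : Fin 3) → not (does (u ≟ v)) ≡ not (does (v ≟ u))
  s Fin.zero Fin.zero = _≡_.refl
  s Fin.zero (Fin.suc Fin.zero) = _≡_.refl
  s Fin.zero (Fin.suc (Fin.suc Fin.zero)) = _≡_.refl
  s (Fin.suc Fin.zero) Fin.zero = _≡_.refl
  s (Fin.suc Fin.zero) (Fin.suc Fin.zero) = _≡_.refl
  s (Fin.suc Fin.zero) (Fin.suc (Fin.suc Fin.zero)) = _≡_.refl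
  s (Fin.suc (Fin.suc Fin.zero)) Fin.zero = _≡_.refl
  s (Fin.suc (Fin.suc Fin.zero)) (Fin.suc Fin.zero) = _≡_.refl
  s (Fin.suc (Fin.suc Fin.zero)) (Fin.suc (Fin.suc Fin.zero)) = _≡_.refl
  r : ∀ (v : Fin 3) → not (does (v ≟ v)) ≡ false
  r Fin.zero = _≡_.refl
  r (Fin.suc Fin.zero) = _≡_.refl
  r (Fin.suc (Fin.suc Fin.zero)) = _≡_.refl

-- the star S_{k+1} on Fin (suc k): centre 0, leaves 1..k
starAdj : ∀ {k} → Fin (suc k) → Fin (suc k) → Bool
starAdj Fin.zero Fin.zero = false
starAdj Fin.zero (Fin.suc _) = true
starAdj (Fin.suc _) Fin.zero = true
starAdj (Fin.suc _) (Fin.suc _) = false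

Star : ℕ → Graph
Star k = record { n = suc k ; adj = starAdj ; sym = s ; irrefl = r }
  where
  s : ∀ (u v : Fin (suc k)) → starAdj u v ≡ starAdj v u
  s Fin.zero Fin.zero = _≡_.refl
  s Fin.zero (Fin.suc _) = _≡_.refl
  s (Fin.suc _) Fin.zero = _≡_.refl
  s (Fin.suc _) (Fin.suc _) = _≡_.refl
  r : ∀ (v : Fin (suc k)) → starAdj v v ≡ false
  r Fin.zero = _≡_.refl
  r (Fin.suc _) = _≡_.refl

-- Symmetric functions in x₁,x₂,… over ℚ, represented by their
-- coefficient function on monomials.  A monomial x^α is given by its
-- exponent list α = (α₁,α₂,…,α_k) (entries beyond the list are 0).

Monomial : Set
Monomial = List ℕ

SymFun : Set
SymFun = Monomial → ℚ

ℕtoℚ : ℕ → ℚ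
ℕtoℚ m = + m / 1

countᵇ : ∀ {A : Set} → (A → Bool) → List A → ℕ
countᵇ p xs = length (filterᵇ p xs)

allᵇ : ∀ {A : Set} → (A → Bool) → List A → Bool
allᵇ p = foldr (λ x b → p x ∧ b) true

allVecs : (m k : ℕ) → List (Vec (Fin k) m)
allVecs zero k = [] ∷ []
allVecs (suc m) k = concatMap (λ v → map (λ i → i ∷ v) (allFin k)) (allVecs m k)

weightAt : ∀ {k m} → Fin k → Vec (Fin k) m → Vec ℕ m → ℕ
weightAt i [] [] = 0
weightAt i (c ∷ f) (w ∷ ws) = (if does (c ≟ i) then w else 0) ℕ.+ weightAt i f ws

hasContent : ∀ {m} (α : Monomial) → Vec ℕ m → Vec (Fin (length α)) m → Bool
hasContent α w f = allᵇ (λ i → weightAt i f w ≡ᵇ List.lookup α i) (allFin (length α))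

-- Chromatic symmetric function X_G: coefficient of x^α is the number of
-- proper colourings κ : V → {1,2,…} with |κ⁻¹(i)| = α_i for all i.
-- (Such a colouring only uses colours i ≤ length α.)
proper : (G : Graph) → ∀ {k} → Vec (Fin k) (n G) → Bool
proper G κ = allᵇ (λ u → allᵇ (λ v → not (adj G u v) ∨ not (does (lookup κ u ≟ lookup κ v)))
                                (allFin (n G)))
                   (allFin (n G))

ones : (m : ℕ) → Vec ℕ m
ones m = Vec.replicate m 1

X : Graph → SymFun
X G α = ℕtoℚ (countᵇ (λ κ → proper G κ ∧ hasContent α (ones (n G)) κ)
                      (allVecs (n G) (length α)))

-- A list of naturals rs = (r₁,…,r_ℓ) encodes the power-sum
-- product p_{r₁+1} ⋯ p_{r_ℓ+1}.  The coefficient of x^α is the number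
-- of maps f from parts to variables with Σ_{f j = i} (r_j+1) = α_i.
pProd : List ℕ → SymFun
pProd rs α = ℕtoℚ (countᵇ (hasContent α (Vec.map suc (Vec.fromList rs)))
                          (allVecs (length rs) (length α)))

-- finite ℚ-linear combinations Σ c · p_{λ}
LinComb : Set
LinComb = List (ℚ × List ℕ)

evalP : LinComb → SymFun
evalP cs α = foldr (λ c acc → proj₁ c ℚ.* pProd (proj₂ c) α ℚ.+ acc) 0ℚ cs

IsPExpansion : SymFun → LinComb → Set
IsPExpansion f cs = ∀ α → f α ≡ evalP cs α

-- ω on a power-sum expansion: ω(p_λ) = (-1)^{|λ|-ℓ(λ)} p_λ,
-- and |λ|-ℓ(λ) = Σ r_j in our encoding.
isEven : ℕ → Bool
isEven zero = true
isEven (suc zero) = false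
isEven (suc (suc m)) = isEven m

signω : List ℕ → ℚ
signω rs = if isEven (sumℕ rs) then 1ℚ else ℚ.- 1ℚ

ωLin : LinComb → LinComb
ωLin = map (λ c → (signω (proj₂ c) ℚ.* proj₁ c , proj₂ c))

-- near chromatic symmetric function Y = (X + ω X)/2, given the
-- power-sum expansion cs of X
Yfrom : SymFun → LinComb → SymFun
Yfrom f cs α = (f α ℚ.+ evalP (ωLin cs) α) ℚ.* ½

-- Γ = ℚ[p₁,p₃,p₅,…]: f is a finite ℚ-combination of products of odd
-- power sums.  Here ds lists pairs (d , μ) meaning d · p_{2μ₁+1}⋯p_{2μ_ℓ+1}.
oddParts : List ℕ → List ℕ
oddParts = map (λ m → m ℕ.+ m)   -- part 2m+1 is encoded as 2m

InΓ : SymFun → Set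
InΓ f = ∃[ ds ] (∀ α → f α ≡ evalP (map (λ d → (proj₁ d , oddParts (proj₂ d))) ds) α)

YInΓ : Graph → Set
YInΓ G = ∃[ cs ] (IsPExpansion (X G) cs × InΓ (Yfrom (X G) cs))

-- Let N be the number of vertices and L the linear functional
--   f ↦ [x₁⋯x_N] f − 4 [x₁²x₂⋯x_{N-1}] f + 4 [x₁²x₂²x₃⋯x_{N-2}] f.
-- Counting the maps from the parts of λ to the variables shows L(p_λ) = 0
-- unless λ = (2,2,1,…,1); that p_λ is fixed by ω and lies outside Γ, so
-- L(Y_G) = L(X_G) while L vanishes on Γ.  Hence Y_G ∈ Γ forces L(X_G) = 0.
-- On the other hand, sorting the colourings of each content by the number of
-- monochromatic edges in their doubled colour classes gives
-- L(X_G) = Σ_κ M₁(κ) M₂(κ) over colourings κ of content x₁²x₂²x₃⋯, where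
-- M_i counts the (ordered) edges of colour i; a pair of disjoint edges makes
-- this positive.  Finally, a connected graph any two of whose edges meet is a
-- star or a triangle.

module Submission where

open import Defs hiding (sym)
open import Data.Bool using (Bool; true; false; T; _∧_; _∨_; not; if_then_else_)
open import Data.Bool.Properties using (∧-zeroʳ; ∧-identityʳ; T-∧) renaming (_≟_ to _≟𝔹_)
open import Data.Unit using (tt)
open import Data.Empty using (⊥; ⊥-elim)
open import Data.Maybe using (Maybe; just; nothing)
open import Data.Nat as ℕ using (ℕ; zero; suc; _+_; _*_; _∸_; _^_; _≤_; _<_; z≤n; s≤s; _≡ᵇ_; _≤ᵇ_; _≤?_; _!)
open import Data.Nat.Properties hiding (_≟_)
open import Data.Nat.Combinatorics.Base using (_P′_)
open import Data.Nat.ListAction using () renaming (sum to sumℕ)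
open import Data.Nat.Tactic.RingSolver using (solve-∀)
open import Data.Fin using (Fin; zero; suc; punchIn)
open import Data.Fin.Properties using (_≟_; any?; punchInᵢ≢i)
open import Data.Fin.Permutation using (transpose)
import Data.Fin.Permutation.Components as PC
open import Data.List as List using (List; []; _∷_; _++_; length; replicate; map; foldr; concatMap; allFin; tabulate)
open import Data.List.Properties using (map-tabulate)
open import Data.Vec as Vec using (Vec; []; _∷_; lookup)
open import Data.Product using (Σ; ∃-syntax; _×_; _,_; proj₁; proj₂)
open import Data.Sum using (_⊎_; inj₁; inj₂; [_,_]′; map₂)
open import Function using (_∘_; id)
open import Function.Bundles using (_↔_; Inverse; Equivalence; mk↔ₛ′)
open import Relation.Nullary using (¬_; Dec; does; yes; no)
open import Relation.Nullary.Decidable using (_×-dec_; ¬?)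
open import Relation.Binary.PropositionalEquality
open import Algebra.Properties.Semiring.Sum +-*-semiring
  using (sum; sum-syntax; sum-cong-≗; ∑-distrib-+; ∑-comm; *-distribˡ-sum; sum-remove)
open import Algebra.Properties.CommutativeMonoid.Sum *-1-commutativeMonoid
  using () renaming (sum to ∏; sum-cong-≗ to ∏-cong; sum-remove to ∏-remove; sum-replicate-zero to ∏-one)
import Data.Integer as ℤ
import Data.Integer.Properties as ℤ
open import Data.Integer.Tactic.RingSolver using () renaming (solve-∀ to ℤ-solve-∀)
open import Data.Rational as ℚ using (ℚ; 0ℚ; 1ℚ; ½; toℚᵘ)
import Data.Rational.Properties as ℚ
open import Data.Rational.Unnormalised as ℚᵘ using (ℚᵘ; mkℚᵘ; *≡*)
import Data.Rational.Unnormalised.Properties as ℚᵘ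
open import Data.Rational.Solver using (module +-*-Solver)
open +-*-Solver using (_:+_; _:*_; _:-_; _:=_; con; solve)
import Relation.Binary.Reasoning.Setoid as SetoidReasoning

𝟙 : Bool → ℕ
𝟙 b = if b then 1 else 0

𝟙-∧ : ∀ a b → 𝟙 (a ∧ b) ≡ 𝟙 a * 𝟙 b
𝟙-∧ true b = sym (+-identityʳ (𝟙 b))
𝟙-∧ false b = refl

𝟙≤1 : ∀ b → 𝟙 b ≤ 1
𝟙≤1 true = ≤-refl
𝟙≤1 false = z≤n

T⇒𝟙≡1 : ∀ {b} → T b → 𝟙 b ≡ 1
T⇒𝟙≡1 {true} _ = refl

¬T⇒𝟙≡0 : ∀ {b} → ¬ T b → 𝟙 b ≡ 0
¬T⇒𝟙≡0 {true} ¬b = ⊥-elim (¬b tt)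
¬T⇒𝟙≡0 {false} _ = refl

T-ext : ∀ {b c} → (T b → T c) → (T c → T b) → b ≡ c
T-ext {false} {false} _ _ = refl
T-ext {false} {true} _ g = ⊥-elim (g tt)
T-ext {true} {false} f _ = ⊥-elim (f tt)
T-ext {true} {true} _ _ = refl

T-allᵇ-tabulate⁻ : ∀ {A : Set} {k} (p : A → Bool) (g : Fin k → A) →
  T (allᵇ p (tabulate g)) → ∀ i → T (p (g i))
T-allᵇ-tabulate⁻ p g t zero = proj₁ (Equivalence.to (T-∧ {p (g zero)}) t)
T-allᵇ-tabulate⁻ p g t (suc i) = T-allᵇ-tabulate⁻ p (g ∘ suc) (proj₂ (Equivalence.to (T-∧ {p (g zero)}) t)) i

T-allᵇ-tabulate⁺ : ∀ {A : Set} {k} (p : A → Bool) (g : Fin k → A) →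
  (∀ i → T (p (g i))) → T (allᵇ p (tabulate g))
T-allᵇ-tabulate⁺ {k = zero} p g h = tt
T-allᵇ-tabulate⁺ {k = suc k} p g h = Equivalence.from (T-∧ {p (g zero)}) (h zero , T-allᵇ-tabulate⁺ p (g ∘ suc) (h ∘ suc))

∑-zero : ∀ k → ∑[ i < k ] 0 ≡ 0
∑-zero zero = refl
∑-zero (suc k) = ∑-zero k

∑-one : ∀ k → ∑[ i < k ] 1 ≡ k
∑-one zero = refl
∑-one (suc k) = cong suc (∑-one k)

∑-*ˡ : ∀ {k} a (f : Fin k → ℕ) → ∑[ i < k ] (a * f i) ≡ a * sum f
∑-*ˡ a f = sym (*-distribˡ-sum a f)

∑-*ʳ : ∀ {k} a (f : Fin k → ℕ) → ∑[ i < k ] (f i * a) ≡ sum f * a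
∑-*ʳ {k} a f = trans (sum-cong-≗ (λ i → *-comm (f i) a)) (trans (∑-*ˡ a f) (*-comm a (sum f)))

∑-mono : ∀ {k} {f g : Fin k → ℕ} → (∀ i → f i ≤ g i) → sum f ≤ sum g
∑-mono {zero} _ = z≤n
∑-mono {suc k} f≤g = +-mono-≤ (f≤g zero) (∑-mono (f≤g ∘ suc))

term≤∑ : ∀ {k} (f : Fin k → ℕ) i → f i ≤ sum f
term≤∑ f zero = m≤m+n _ _
term≤∑ f (suc i) = ≤-trans (term≤∑ (f ∘ suc) i) (m≤n+m _ (f zero))

∑≡0⇒≡0 : ∀ {k} (f : Fin k → ℕ) → sum f ≡ 0 → ∀ i → f i ≡ 0
∑≡0⇒≡0 f eq i = n≤0⇒n≡0 (≤-trans (term≤∑ f i) (≤-reflexive eq))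

∑-update : ∀ {k} (f g : Fin k → ℕ) i → (∀ j → j ≢ i → f j ≡ g j) → sum f + g i ≡ sum g + f i
∑-update {suc k} f g i agree = begin
  sum f + g i                       ≡⟨ cong (_+ g i) (sum-remove {i = i} f) ⟩
  f i + rest f + g i                ≡⟨ cong (λ r → f i + r + g i) (sum-cong-≗ off-i) ⟩
  f i + rest g + g i                ≡⟨ solve₃ (f i) (rest g) (g i) ⟩
  g i + rest g + f i                ≡⟨ cong (_+ f i) (sum-remove {i = i} g) ⟨
  sum g + f i                       ∎
  where
  open ≡-Reasoning
  rest : (Fin (suc k) → ℕ) → ℕ
  rest h = sum (h ∘ punchIn i)
  off-i : ∀ j → f (punchIn i j) ≡ g (punchIn i j)
  off-i j = agree (punchIn i j) (punchInᵢ≢i i j)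
  solve₃ : ∀ a r b → a + r + b ≡ b + r + a
  solve₃ = solve-∀

∑-single : ∀ {k} (f : Fin k → ℕ) i → (∀ j → j ≢ i → f j ≡ 0) → sum f ≡ f i
∑-single {k} f i zero-off-i = begin
  sum f                  ≡⟨ +-identityʳ (sum f) ⟨
  sum f + 0              ≡⟨ ∑-update f (λ _ → 0) i zero-off-i ⟩
  ∑[ j < k ] 0 + f i     ≡⟨ cong (_+ f i) (∑-zero k) ⟩
  f i                    ∎
  where open ≡-Reasoning

∑ᵛ : ∀ {k m} → (Vec (Fin k) m → ℕ) → ℕ
∑ᵛ {m = zero} F = F []
∑ᵛ {k} {suc m} F = ∑[ i < k ] ∑ᵛ (λ v → F (i ∷ v))

∑ᵛ-cong : ∀ {k m} {F G : Vec (Fin k) m → ℕ} → (∀ v → F v ≡ G v) → ∑ᵛ F ≡ ∑ᵛ G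
∑ᵛ-cong {m = zero} F≗G = F≗G []
∑ᵛ-cong {m = suc m} F≗G = sum-cong-≗ (λ i → ∑ᵛ-cong (λ v → F≗G (i ∷ v)))

∑ᵛ-zero : ∀ {k m} → ∑ᵛ {k} {m} (λ _ → 0) ≡ 0
∑ᵛ-zero {k} {zero} = refl
∑ᵛ-zero {k} {suc m} = trans (sum-cong-≗ {k} (λ _ → ∑ᵛ-zero {k} {m})) (∑-zero k)

∑ᵛ-+ : ∀ {k m} (F G : Vec (Fin k) m → ℕ) → ∑ᵛ (λ v → F v + G v) ≡ ∑ᵛ F + ∑ᵛ G
∑ᵛ-+ {m = zero} F G = refl
∑ᵛ-+ {m = suc m} F G =
  trans (sum-cong-≗ (λ i → ∑ᵛ-+ (F ∘ (i ∷_)) (G ∘ (i ∷_)))) (∑-distrib-+ (λ i → ∑ᵛ (F ∘ (i ∷_))) (λ i → ∑ᵛ (G ∘ (i ∷_))))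

∑ᵛ-*ˡ : ∀ {k m} a (F : Vec (Fin k) m → ℕ) → ∑ᵛ (λ v → a * F v) ≡ a * ∑ᵛ F
∑ᵛ-*ˡ {m = zero} a F = refl
∑ᵛ-*ˡ {m = suc m} a F = trans (sum-cong-≗ (λ i → ∑ᵛ-*ˡ a (F ∘ (i ∷_)))) (∑-*ˡ a (λ i → ∑ᵛ (F ∘ (i ∷_))))

∑ᵛ-mono : ∀ {k m} {F G : Vec (Fin k) m → ℕ} → (∀ v → F v ≤ G v) → ∑ᵛ F ≤ ∑ᵛ G
∑ᵛ-mono {m = zero} F≤G = F≤G []
∑ᵛ-mono {m = suc m} F≤G = ∑-mono (λ i → ∑ᵛ-mono (λ v → F≤G (i ∷ v)))

∑ᵛ-∑-comm : ∀ {k m n} (F : Vec (Fin k) m → Fin n → ℕ) →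
  ∑ᵛ (λ v → ∑[ j < n ] F v j) ≡ ∑[ j < n ] ∑ᵛ (λ v → F v j)
∑ᵛ-∑-comm {m = zero} F = refl
∑ᵛ-∑-comm {m = suc m} F =
  trans (sum-cong-≗ (λ i → ∑ᵛ-∑-comm (F ∘ (i ∷_)))) (∑-comm (λ i j → ∑ᵛ (λ v → F (i ∷ v) j)))

∑ₗ : ∀ {A : Set} → List A → (A → ℕ) → ℕ
∑ₗ [] F = 0
∑ₗ (x ∷ xs) F = F x + ∑ₗ xs F

countᵇ≡∑ₗ : ∀ {A : Set} (p : A → Bool) xs → countᵇ p xs ≡ ∑ₗ xs (𝟙 ∘ p)
countᵇ≡∑ₗ p [] = refl
countᵇ≡∑ₗ p (x ∷ xs) with p x
... | true = cong suc (countᵇ≡∑ₗ p xs)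
... | false = countᵇ≡∑ₗ p xs

∑ₗ-cong : ∀ {A : Set} xs {F G : A → ℕ} → (∀ x → F x ≡ G x) → ∑ₗ xs F ≡ ∑ₗ xs G
∑ₗ-cong [] F≗G = refl
∑ₗ-cong (x ∷ xs) F≗G = cong₂ _+_ (F≗G x) (∑ₗ-cong xs F≗G)

∑ₗ-++ : ∀ {A : Set} xs ys (F : A → ℕ) → ∑ₗ (xs ++ ys) F ≡ ∑ₗ xs F + ∑ₗ ys F
∑ₗ-++ [] ys F = refl
∑ₗ-++ (x ∷ xs) ys F = trans (cong (F x +_) (∑ₗ-++ xs ys F)) (sym (+-assoc (F x) _ _))

∑ₗ-concatMap : ∀ {A B : Set} (g : A → List B) xs F → ∑ₗ (concatMap g xs) F ≡ ∑ₗ xs (λ x → ∑ₗ (g x) F)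
∑ₗ-concatMap g [] F = refl
∑ₗ-concatMap g (x ∷ xs) F = trans (∑ₗ-++ (g x) (concatMap g xs) F) (cong (∑ₗ (g x) F +_) (∑ₗ-concatMap g xs F))

∑ₗ-tabulate : ∀ {A : Set} {k} (g : Fin k → A) F → ∑ₗ (tabulate g) F ≡ ∑[ i < k ] F (g i)
∑ₗ-tabulate {k = zero} g F = refl
∑ₗ-tabulate {k = suc k} g F = cong (F (g zero) +_) (∑ₗ-tabulate (g ∘ suc) F)

∑ₗ-∑-comm : ∀ {A : Set} {n} xs (F : A → Fin n → ℕ) → ∑ₗ xs (λ x → ∑[ j < n ] F x j) ≡ ∑[ j < n ] ∑ₗ xs (λ x → F x j)
∑ₗ-∑-comm {n = n} [] F = sym (∑-zero n)
∑ₗ-∑-comm (x ∷ xs) F = trans (cong (sum (F x) +_) (∑ₗ-∑-comm xs F)) (sym (∑-distrib-+ (F x) _))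

∑ₗ-allVecs : ∀ m k (F : Vec (Fin k) m → ℕ) → ∑ₗ (allVecs m k) F ≡ ∑ᵛ F
∑ₗ-allVecs zero k F = +-identityʳ (F [])
∑ₗ-allVecs (suc m) k F = begin
  ∑ₗ (concatMap extend (allVecs m k)) F                    ≡⟨ ∑ₗ-concatMap extend (allVecs m k) F ⟩
  ∑ₗ (allVecs m k) (λ v → ∑ₗ (extend v) F)                 ≡⟨ ∑ₗ-cong (allVecs m k) extend-sum ⟩
  ∑ₗ (allVecs m k) (λ v → ∑[ i < k ] F (i ∷ v))            ≡⟨ ∑ₗ-∑-comm (allVecs m k) (λ v i → F (i ∷ v)) ⟩
  ∑[ i < k ] ∑ₗ (allVecs m k) (λ v → F (i ∷ v))            ≡⟨ sum-cong-≗ (λ i → ∑ₗ-allVecs m k (F ∘ (i ∷_))) ⟩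
  ∑ᵛ F                                                     ∎
  where
  open ≡-Reasoning
  extend : Vec (Fin k) m → List (Vec (Fin k) (suc m))
  extend v = map (_∷ v) (allFin k)
  extend-sum : ∀ v → ∑ₗ (extend v) F ≡ ∑[ i < k ] F (i ∷ v)
  extend-sum v = trans (cong (λ xs → ∑ₗ xs F) (map-tabulate id (_∷ v))) (∑ₗ-tabulate (_∷ v) F)

countᵇ-allVecs : ∀ m k (p : Vec (Fin k) m → Bool) → countᵇ p (allVecs m k) ≡ ∑ᵛ (𝟙 ∘ p)
countᵇ-allVecs m k p = trans (countᵇ≡∑ₗ p (allVecs m k)) (∑ₗ-allVecs m k (𝟙 ∘ p))

-- Counting maps of prescribed content

-- The subtraction is truncated; lemmas that need a ≤ c i assume it.

lower : ∀ {k} → (Fin k → ℕ) → Fin k → ℕ → Fin k → ℕ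
lower c i a j = if does (i ≟ j) then c j ∸ a else c j

lower-self : ∀ {k} (c : Fin k → ℕ) i a → lower c i a i ≡ c i ∸ a
lower-self c i a with i ≟ i
... | yes _ = refl
... | no i≢i = ⊥-elim (i≢i refl)

lower-other : ∀ {k} (c : Fin k → ℕ) i a j → j ≢ i → lower c i a j ≡ c j
lower-other c i a j j≢i with i ≟ j
... | yes i≡j = ⊥-elim (j≢i (sym i≡j))
... | no _ = refl

lower-≤ : ∀ {k} (c : Fin k → ℕ) i a j → lower c i a j ≤ c j
lower-≤ c i a j with does (i ≟ j)
... | true = m∸n≤m (c j) a
... | false = ≤-refl

∑-lower : ∀ {k} (c : Fin k → ℕ) i a → a ≤ c i → sum (lower c i a) + a ≡ sum c
∑-lower c i a a≤cᵢ = +-cancelʳ-≡ (c i ∸ a) _ _ (begin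
  sum (lower c i a) + a + (c i ∸ a)         ≡⟨ +-assoc (sum (lower c i a)) a (c i ∸ a) ⟩
  sum (lower c i a) + (a + (c i ∸ a))       ≡⟨ cong (sum (lower c i a) +_) (m+[n∸m]≡n a≤cᵢ) ⟩
  sum (lower c i a) + c i                   ≡⟨ ∑-update (lower c i a) c i (lower-other c i a) ⟩
  sum c + lower c i a i                     ≡⟨ cong (sum c +_) (lower-self c i a) ⟩
  sum c + (c i ∸ a)                         ∎)
  where open ≡-Reasoning

∑-lower-≡ : ∀ {k} (c : Fin k → ℕ) i a {D} → a ≤ c i → sum c ≡ a + D → sum (lower c i a) ≡ D
∑-lower-≡ c i a {D} a≤cᵢ total = +-cancelʳ-≡ a _ _ (trans (∑-lower c i a a≤cᵢ) (trans total (+-comm a D)))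

∏-lower-! : ∀ {k} (d : Fin k → ℕ) i e → d i ≡ suc e → ∏ (λ j → d j !) ≡ suc e * ∏ (λ j → lower d i 1 j !)
∏-lower-! {suc k} d i e dᵢ≡1+e = begin
  ∏ (λ j → d j !)                                  ≡⟨ ∏-remove {i = i} (λ j → d j !) ⟩
  d i ! * rest d                                   ≡⟨ cong (λ z → z ! * rest d) dᵢ≡1+e ⟩
  suc e * e ! * rest d                             ≡⟨ *-assoc (suc e) (e !) (rest d) ⟩
  suc e * (e ! * rest d)                           ≡⟨ cong₂ (λ z r → suc e * (z ! * r)) lowered (∏-cong off-i) ⟨
  suc e * (lower d i 1 i ! * rest (lower d i 1))   ≡⟨ cong (suc e *_) (∏-remove {i = i} (λ j → lower d i 1 j !)) ⟨
  suc e * ∏ (λ j → lower d i 1 j !)                ∎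
  where
  open ≡-Reasoning
  rest : (Fin (suc k) → ℕ) → ℕ
  rest h = ∏ (λ j → h (punchIn i j) !)
  lowered : lower d i 1 i ≡ e
  lowered = trans (lower-self d i 1) (cong (_∸ 1) dᵢ≡1+e)
  off-i : ∀ j → lower d i 1 (punchIn i j) ! ≡ d (punchIn i j) !
  off-i j = cong _! (lower-other d i 1 (punchIn i j) (punchInᵢ≢i i j))

-- hasContent α of Defs is contentᵇ (List.lookup α) by definition.
contentᵇ : ∀ {k m} → (Fin k → ℕ) → Vec ℕ m → Vec (Fin k) m → Bool
contentᵇ c w f = allᵇ (λ i → weightAt i f w ≡ᵇ c i) (allFin _)

contentᵇ⁻ : ∀ {k m} (c : Fin k → ℕ) w (f : Vec (Fin k) m) → T (contentᵇ c w f) → ∀ i → weightAt i f w ≡ c i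
contentᵇ⁻ c w f t i = ≡ᵇ⇒≡ _ _ (T-allᵇ-tabulate⁻ _ id t i)

contentᵇ⁺ : ∀ {k m} (c : Fin k → ℕ) w (f : Vec (Fin k) m) → (∀ i → weightAt i f w ≡ c i) → T (contentᵇ c w f)
contentᵇ⁺ c w f h = T-allᵇ-tabulate⁺ _ id (λ i → ≡⇒≡ᵇ _ _ (h i))

contentᵇ-∷ : ∀ {k m} (c : Fin k → ℕ) a (w : Vec ℕ m) i f →
  contentᵇ c (a ∷ w) (i ∷ f) ≡ (a ≤ᵇ c i) ∧ contentᵇ (lower c i a) w f
contentᵇ-∷ c a w i f = T-ext forward backward
  where
  forward : T (contentᵇ c (a ∷ w) (i ∷ f)) → T ((a ≤ᵇ c i) ∧ contentᵇ (lower c i a) w f)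
  forward t = Equivalence.from (T-∧ {a ≤ᵇ c i}) (≤⇒≤ᵇ a≤cᵢ , contentᵇ⁺ _ w f rest)
    where
    weights = contentᵇ⁻ c (a ∷ w) (i ∷ f) t
    at-i : a + weightAt i f w ≡ c i
    at-i with i ≟ i | weights i
    ... | yes _ | eq = eq
    ... | no i≢i | _ = ⊥-elim (i≢i refl)
    a≤cᵢ : a ≤ c i
    a≤cᵢ = subst (a ≤_) at-i (m≤m+n a _)
    rest : ∀ j → weightAt j f w ≡ lower c i a j
    rest j with i ≟ j | weights j
    ... | yes refl | eq = sym (trans (cong (_∸ a) (sym eq)) (m+n∸m≡n a _))
    ... | no _ | eq = eq
  backward : T ((a ≤ᵇ c i) ∧ contentᵇ (lower c i a) w f) → T (contentᵇ c (a ∷ w) (i ∷ f))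
  backward t = contentᵇ⁺ c (a ∷ w) (i ∷ f) all
    where
    a≤cᵢ = ≤ᵇ⇒≤ a (c i) (proj₁ (Equivalence.to (T-∧ {a ≤ᵇ c i}) t))
    rest = contentᵇ⁻ _ w f (proj₂ (Equivalence.to (T-∧ {a ≤ᵇ c i}) t))
    all : ∀ j → (if does (i ≟ j) then a else 0) + weightAt j f w ≡ c j
    all j with i ≟ j | rest j
    ... | yes refl | eq = trans (cong (a +_) eq) (m+[n∸m]≡n a≤cᵢ)
    ... | no _ | eq = eq

Pins : ℕ → ℕ → Set
Pins k m = Fin m → Maybe (Fin k)

fitsᵇ : ∀ {k} → Maybe (Fin k) → Fin k → Bool
fitsᵇ nothing _ = true
fitsᵇ (just y) x = does (x ≟ y)

respectsᵇ : ∀ {k m} → Pins k m → Vec (Fin k) m → Bool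
respectsᵇ p [] = true
respectsᵇ p (x ∷ f) = fitsᵇ (p zero) x ∧ respectsᵇ (p ∘ suc) f

count : ∀ {k m} → Vec ℕ m → Pins k m → (Fin k → ℕ) → ℕ
count w p c = ∑ᵛ (λ f → 𝟙 (contentᵇ c w f ∧ respectsᵇ p f))

count-∷ : ∀ {k m} a (w : Vec ℕ m) (p : Pins k (suc m)) c →
  count (a ∷ w) p c ≡ ∑[ i < k ] (if fitsᵇ (p zero) i ∧ (a ≤ᵇ c i) then count w (p ∘ suc) (lower c i a) else 0)
count-∷ {k} {m} a w p c = sum-cong-≗ λ i → trans (∑ᵛ-cong (λ f → cong 𝟙 (reorder i f))) (pull-out i)
  where
  fits-a : Fin _ → Bool
  fits-a i = fitsᵇ (p zero) i ∧ (a ≤ᵇ c i)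
  rest : Fin _ → Vec (Fin _) _ → Bool
  rest i f = contentᵇ (lower c i a) w f ∧ respectsᵇ (p ∘ suc) f
  reorder : ∀ i f → contentᵇ c (a ∷ w) (i ∷ f) ∧ respectsᵇ p (i ∷ f) ≡ fits-a i ∧ rest i f
  reorder i f rewrite contentᵇ-∷ c a w i f with a ≤ᵇ c i | fitsᵇ (p zero) i
  ... | true | true = refl
  ... | true | false = ∧-zeroʳ _
  ... | false | true = refl
  ... | false | false = refl
  pull-out : ∀ i → ∑ᵛ (λ f → 𝟙 (fits-a i ∧ rest i f)) ≡ (if fits-a i then count w (p ∘ suc) (lower c i a) else 0)
  pull-out i with fits-a i
  ... | true = refl
  ... | false = ∑ᵛ-zero {k} {m}

pinnedTo : ∀ {k} → Maybe (Fin k) → Fin k → ℕ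
pinnedTo nothing _ = 0
pinnedTo (just y) x = 𝟙 (does (y ≟ x))

isFree : ∀ {k} → Maybe (Fin k) → ℕ
isFree nothing = 1
isFree (just _) = 0

load : ∀ {k m} → Pins k m → Fin k → ℕ
load {m = m} p x = ∑[ j < m ] pinnedTo (p j) x

free : ∀ {k m} → Pins k m → ℕ
free {m = m} p = ∑[ j < m ] isFree (p j)

load≤weightAt : ∀ {k m} (p : Pins k m) f → T (respectsᵇ p f) → ∀ x → load p x ≤ weightAt x f (ones m)
load≤weightAt p [] _ x = z≤n
load≤weightAt p (y ∷ f) t x with p zero | Equivalence.to (T-∧ {fitsᵇ (p zero) y}) t
... | nothing | _ , rest = ≤-trans (load≤weightAt (p ∘ suc) f rest x) (m≤n+m _ _)
... | just z | fits , rest with y ≟ z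
... | yes refl = +-monoʳ-≤ (𝟙 (does (y ≟ x))) (load≤weightAt (p ∘ suc) f rest x)
... | no _ = ⊥-elim fits

count-overloaded : ∀ {k m} (p : Pins k m) c x → c x < load p x → count (ones m) p c ≡ 0
count-overloaded {k} {m} p c x cₓ<load = trans (∑ᵛ-cong none) (∑ᵛ-zero {k} {m})
  where
  none : ∀ f → 𝟙 (contentᵇ c (ones m) f ∧ respectsᵇ p f) ≡ 0
  none f = ¬T⇒𝟙≡0 λ t → let (content , respects) = Equivalence.to (T-∧ {contentᵇ c (ones m) f}) t in
    <-irrefl refl (≤-trans cₓ<load (≤-trans (load≤weightAt p f respects x) (≤-reflexive (contentᵇ⁻ c (ones m) f content x))))

∑-weightAt : ∀ {k m} (f : Vec (Fin k) m) w → sum (λ x → weightAt x f w) ≡ Vec.sum w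
∑-weightAt {k} [] [] = ∑-zero k
∑-weightAt {k} (i ∷ f) (a ∷ w) = trans (∑-distrib-+ (λ x → if does (i ≟ x) then a else 0) (λ x → weightAt x f w))
  (cong₂ _+_ (trans (∑-single _ i off-i) (at-i)) (∑-weightAt f w))
  where
  off-i : ∀ x → x ≢ i → (if does (i ≟ x) then a else 0) ≡ 0
  off-i x x≢i with i ≟ x
  ... | yes i≡x = ⊥-elim (x≢i (sym i≡x))
  ... | no _ = refl
  at-i : (if does (i ≟ i) then a else 0) ≡ a
  at-i with i ≟ i
  ... | yes _ = refl
  ... | no i≢i = ⊥-elim (i≢i refl)

count-wrong-degree : ∀ {k m} (w : Vec ℕ m) (p : Pins k m) c → sum c ≢ Vec.sum w → count w p c ≡ 0
count-wrong-degree {k} {m} w p c sum≢ = trans (∑ᵛ-cong none) (∑ᵛ-zero {k} {m})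
  where
  none : ∀ f → 𝟙 (contentᵇ c w f ∧ respectsᵇ p f) ≡ 0
  none f = ¬T⇒𝟙≡0 λ t → sum≢ (trans (sum-cong-≗ (λ x → sym (contentᵇ⁻ c w f (proj₁ (Equivalence.to (T-∧ {contentᵇ c w f}) t)) x))) (∑-weightAt f w))

∑-at : ∀ {k} (y : Fin k) (b : Fin k → Bool) (X : Fin k → ℕ) → T (b y) →
  ∑[ i < k ] (if does (i ≟ y) ∧ b i then X i else 0) ≡ X y
∑-at y b X t = trans (∑-single _ y off-y) at-y
  where
  off-y : ∀ i → i ≢ y → (if does (i ≟ y) ∧ b i then X i else 0) ≡ 0
  off-y i i≢y with i ≟ y
  ... | yes i≡y = ⊥-elim (i≢y i≡y)
  ... | no _ = refl
  at-y : (if does (y ≟ y) ∧ b y then X y else 0) ≡ X y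
  at-y with y ≟ y | b y
  ... | yes _ | true = refl
  ... | no y≢y | _ = ⊥-elim (y≢y refl)

𝟙-refl : ∀ {k} (y : Fin k) → 𝟙 (does (y ≟ y)) ≡ 1
𝟙-refl y with y ≟ y
... | yes _ = refl
... | no y≢y = ⊥-elim (y≢y refl)

unpin : ∀ {k} (L c : Fin k → ℕ) y → (∀ x → 𝟙 (does (y ≟ x)) + L x ≡ c x) → ∀ x → L x ≡ lower c y 1 x
unpin L c y split x with y ≟ x | split x
... | yes refl | eq = cong (_∸ 1) eq
... | no _ | eq = eq

lower-split : ∀ {k} (L d c : Fin k → ℕ) i → (∀ x → L x + d x ≡ c x) → 1 ≤ d i →
  ∀ x → L x + lower d i 1 x ≡ lower c i 1 x
lower-split L d c i split 1≤dᵢ x with i ≟ x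
... | yes refl = trans (sym (+-∸-assoc (L i) 1≤dᵢ)) (cong (_∸ 1) (split i))
... | no _ = split x

count-∷-pinned : ∀ {k m} w (p : Pins k (suc m)) c {y} → p zero ≡ just y → 1 ≤ c y →
  count (1 ∷ w) p c ≡ count w (p ∘ suc) (lower c y 1)
count-∷-pinned w p c {y} p₀ 1≤c[y] rewrite count-∷ 1 w p c | p₀ =
  ∑-at y (λ i → 1 ≤ᵇ c i) (λ i → count w (p ∘ suc) (lower c i 1)) (≤⇒≤ᵇ 1≤c[y])

count-∷-free : ∀ {k m} w (p : Pins k (suc m)) c → p zero ≡ nothing →
  count (1 ∷ w) p c ≡ ∑[ i < k ] (if 1 ≤ᵇ c i then count w (p ∘ suc) (lower c i 1) else 0)
count-∷-free w p c p₀ rewrite count-∷ 1 w p c | p₀ = refl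

Multinomial : ℕ → Set
Multinomial m = ∀ {k} (p : Pins k m) (c d : Fin k → ℕ) →
  (∀ x → load p x + d x ≡ c x) → sum d ≡ free p →
  ∏ (λ x → d x !) * count (ones m) p c ≡ free p !

multinomial-[] : Multinomial 0
multinomial-[] {k} p c d split total = begin
  ∏ (λ x → d x !) * 𝟙 (contentᵇ c [] [] ∧ true)
      ≡⟨ cong₂ _*_ (∏-cong (λ x → cong _! (d≡0 x))) (T⇒𝟙≡1 (Equivalence.from (T-∧ {contentᵇ c [] []}) (empty , tt))) ⟩
  ∏ {k} (λ _ → 1) * 1                              ≡⟨ cong (_* 1) (∏-one k) ⟩
  1                                                ∎
  where
  open ≡-Reasoning
  d≡0 = ∑≡0⇒≡0 d total
  empty : T (contentᵇ c [] [])
  empty = contentᵇ⁺ c [] [] (λ x → trans (sym (d≡0 x)) (split x))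

module _ {m} (multinomial-m : Multinomial m) {k} (p : Pins k (suc m)) (c d : Fin k → ℕ) where

  private
    p′ = p ∘ suc
    d! = λ x → d x !

  multinomial-pinned : ∀ {y} → p zero ≡ just y → (∀ x → load p x + d x ≡ c x) → sum d ≡ free p →
    ∏ d! * count (ones (suc m)) p c ≡ free p !
  multinomial-pinned {y} p₀ split total = begin
    ∏ d! * count (ones (suc m)) p c                 ≡⟨ cong (∏ d! *_) (count-∷-pinned (ones m) p c p₀ 1≤c[y]) ⟩
    ∏ d! * count (ones m) p′ (lower c y 1)          ≡⟨ multinomial-m p′ (lower c y 1) d split′ total′ ⟩
    free p′ !                                       ≡⟨ cong (λ q → (isFree q + free p′) !) p₀ ⟨
    free p !                                        ∎
    where
    open ≡-Reasoning
    pinned-split : ∀ x → 𝟙 (does (y ≟ x)) + (load p′ x + d x) ≡ c x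
    pinned-split x = trans (sym (+-assoc (𝟙 (does (y ≟ x))) _ _)) (trans (cong (λ q → pinnedTo q x + load p′ x + d x) (sym p₀)) (split x))
    split′ : ∀ x → load p′ x + d x ≡ lower c y 1 x
    split′ = unpin (λ x → load p′ x + d x) c y pinned-split
    1≤c[y] : 1 ≤ c y
    1≤c[y] = subst (1 ≤_) (pinned-split y) (≤-trans (≤-reflexive (sym (𝟙-refl y))) (m≤m+n _ _))
    total′ : sum d ≡ free p′
    total′ = trans total (cong (λ q → isFree q + free p′) p₀)

  multinomial-free : p zero ≡ nothing → (∀ x → load p x + d x ≡ c x) → sum d ≡ free p →
    ∏ d! * count (ones (suc m)) p c ≡ free p !
  multinomial-free p₀ split total = begin
    ∏ d! * count (ones (suc m)) p c                ≡⟨ cong (∏ d! *_) (count-∷-free (ones m) p c p₀) ⟩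
    ∏ d! * ∑[ i < k ] term i                       ≡⟨ ∑-*ˡ (∏ d!) term ⟨
    ∑[ i < k ] (∏ d! * term i)                     ≡⟨ sum-cong-≗ per-colour ⟩
    ∑[ i < k ] (d i * free p′ !)                   ≡⟨ ∑-*ʳ (free p′ !) d ⟩
    sum d * free p′ !                              ≡⟨ cong (_* free p′ !) total′ ⟩
    suc (free p′) !                                ≡⟨ cong (λ q → (isFree q + free p′) !) p₀ ⟨
    free p !                                       ∎
    where
    open ≡-Reasoning
    term : Fin k → ℕ
    term i = if 1 ≤ᵇ c i then count (ones m) p′ (lower c i 1) else 0
    split′ : ∀ x → load p′ x + d x ≡ c x
    split′ x = trans (cong (λ q → pinnedTo q x + load p′ x + d x) (sym p₀)) (split x)
    total′ : sum d ≡ suc (free p′)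
    total′ = trans total (cong (λ q → isFree q + free p′) p₀)
    per-colour : ∀ i → ∏ d! * term i ≡ d i * free p′ !
    per-colour i with d i in dᵢ | c i in cᵢ
    ... | zero | zero = *-zeroʳ (∏ d!)
    ... | zero | suc c′ = trans (cong (∏ d! *_) (count-overloaded p′ (lower c i 1) i overloaded)) (*-zeroʳ (∏ d!))
      where
      overloaded : lower c i 1 i < load p′ i
      overloaded = subst₂ _<_ (sym (trans (lower-self c i 1) (cong (_∸ 1) cᵢ)))
        (trans (sym cᵢ) (trans (sym (split′ i)) (trans (cong (load p′ i +_) dᵢ) (+-identityʳ _)))) ≤-refl
    ... | suc e | zero = ⊥-elim (0≢1+n (trans (sym cᵢ) (trans (sym (split′ i)) (trans (cong (load p′ i +_) dᵢ) (+-suc _ e)))))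
    ... | suc e | suc c′ = begin
      ∏ d! * count (ones m) p′ (lower c i 1)                              ≡⟨ cong (_* count (ones m) p′ (lower c i 1)) (∏-lower-! d i e dᵢ) ⟩
      suc e * ∏ (λ x → lower d i 1 x !) * count (ones m) p′ (lower c i 1)  ≡⟨ *-assoc (suc e) (∏ (λ x → lower d i 1 x !)) (count (ones m) p′ (lower c i 1)) ⟩
      suc e * (∏ (λ x → lower d i 1 x !) * count (ones m) p′ (lower c i 1)) ≡⟨ cong (suc e *_) (multinomial-m p′ (lower c i 1) (lower d i 1) split″ total″) ⟩
      suc e * free p′ !                                                   ∎
      where
      1≤dᵢ : 1 ≤ d i
      1≤dᵢ = subst (1 ≤_) (sym dᵢ) (s≤s z≤n)
      split″ : ∀ x → load p′ x + lower d i 1 x ≡ lower c i 1 x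
      split″ = lower-split (load p′) d c i split′ 1≤dᵢ
      total″ : sum (lower d i 1) ≡ free p′
      total″ = suc-injective (trans (+-comm 1 _) (trans (∑-lower d i 1 1≤dᵢ) total′))

multinomial : ∀ m → Multinomial m
multinomial zero = multinomial-[]
multinomial (suc m) {k} p c d = by-first-pin (p zero) refl
  where
  by-first-pin : ∀ q → p zero ≡ q → (∀ x → load p x + d x ≡ c x) → sum d ≡ free p →
    ∏ (λ x → d x !) * count (ones (suc m)) p c ≡ free p !
  by-first-pin (just _) p₀ = multinomial-pinned (multinomial m) p c d p₀
  by-first-pin nothing p₀ = multinomial-free (multinomial m) p c d p₀

δ : ∀ {k m} → Vec (Fin k) m → Fin m → Fin k → ℕ
δ f j a = 𝟙 (does (lookup f j ≟ a))

noPins : ∀ {k m} → Pins k m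
noPins _ = nothing

load-noPins : ∀ {k} m (x : Fin k) → load {m = m} noPins x ≡ 0
load-noPins m x = ∑-zero m

free-noPins : ∀ {k} m → free {k} {m} noPins ≡ m
free-noPins m = ∑-one m

respectsᵇ-noPins : ∀ {k m} (f : Vec (Fin k) m) → respectsᵇ noPins f ≡ true
respectsᵇ-noPins [] = refl
respectsᵇ-noPins (x ∷ f) = respectsᵇ-noPins f

pinAt : ∀ {k m} → Fin m → Fin k → Pins k m → Pins k m
pinAt j a p j′ = if does (j′ ≟ j) then just a else p j′

pinAt-self : ∀ {k m} j a (p : Pins k m) → pinAt j a p j ≡ just a
pinAt-self j a p with j ≟ j
... | yes _ = refl
... | no j≢j = ⊥-elim (j≢j refl)

pinAt-other : ∀ {k m} {j j′} a (p : Pins k m) → j′ ≢ j → pinAt j a p j′ ≡ p j′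
pinAt-other {j = j} {j′} a p j′≢j with j′ ≟ j
... | yes j′≡j = ⊥-elim (j′≢j j′≡j)
... | no _ = refl

load-pinAt : ∀ {k m} j a (p : Pins k m) → p j ≡ nothing → ∀ x → load (pinAt j a p) x ≡ 𝟙 (does (a ≟ x)) + load p x
load-pinAt j a p pⱼ x = begin
  load (pinAt j a p) x                              ≡⟨ +-identityʳ _ ⟨
  load (pinAt j a p) x + 0                          ≡⟨ cong (λ q → load (pinAt j a p) x + pinnedTo q x) pⱼ ⟨
  load (pinAt j a p) x + pinnedTo (p j) x           ≡⟨ ∑-update _ _ j (λ j′ j′≢j → cong (λ q → pinnedTo q x) (pinAt-other a p j′≢j)) ⟩
  load p x + pinnedTo (pinAt j a p j) x             ≡⟨ cong (λ q → load p x + pinnedTo q x) (pinAt-self j a p) ⟩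
  load p x + 𝟙 (does (a ≟ x))                       ≡⟨ +-comm (load p x) _ ⟩
  𝟙 (does (a ≟ x)) + load p x                       ∎
  where open ≡-Reasoning

free-pinAt : ∀ {k m} j a (p : Pins k m) → p j ≡ nothing → free (pinAt j a p) + 1 ≡ free p
free-pinAt j a p pⱼ = begin
  free (pinAt j a p) + 1                            ≡⟨ cong (λ q → free (pinAt j a p) + isFree q) pⱼ ⟨
  free (pinAt j a p) + isFree (p j)                 ≡⟨ ∑-update _ _ j (λ j′ j′≢j → cong isFree (pinAt-other a p j′≢j)) ⟩
  free p + isFree (pinAt j a p j)                   ≡⟨ cong (λ q → free p + isFree q) (pinAt-self j a p) ⟩
  free p + 0                                        ≡⟨ +-identityʳ _ ⟩
  free p                                            ∎
  where open ≡-Reasoning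

𝟙-respectsᵇ-pinAt : ∀ {k m} j a (p : Pins k m) → p j ≡ nothing →
  ∀ f → 𝟙 (respectsᵇ (pinAt j a p) f) ≡ δ f j a * 𝟙 (respectsᵇ p f)
𝟙-respectsᵇ-pinAt zero a p p₀ (x ∷ f) rewrite p₀ = 𝟙-∧ (does (x ≟ a)) _
𝟙-respectsᵇ-pinAt (suc j) a p pⱼ (x ∷ f) = begin
  𝟙 (fits ∧ respectsᵇ (pinAt j a (p ∘ suc)) f)       ≡⟨ 𝟙-∧ fits _ ⟩
  𝟙 fits * 𝟙 (respectsᵇ (pinAt j a (p ∘ suc)) f)     ≡⟨ cong (𝟙 fits *_) (𝟙-respectsᵇ-pinAt j a (p ∘ suc) pⱼ f) ⟩
  𝟙 fits * (δ f j a * 𝟙 (respectsᵇ (p ∘ suc) f))     ≡⟨ swap (𝟙 fits) (δ f j a) _ ⟩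
  δ f j a * (𝟙 fits * 𝟙 (respectsᵇ (p ∘ suc) f))     ≡⟨ cong (δ f j a *_) (𝟙-∧ fits _) ⟨
  δ f j a * 𝟙 (fits ∧ respectsᵇ (p ∘ suc) f)         ∎
  where
  open ≡-Reasoning
  fits = fitsᵇ (p zero) x
  swap : ∀ a b c → a * (b * c) ≡ b * (a * c)
  swap = solve-∀

pinPair : ∀ {k m} → Fin m → Fin m → Fin k → Pins k m → Pins k m
pinPair u v a p = pinAt u a (pinAt v a p)

module _ {k m} {u v : Fin m} (a : Fin k) (p : Pins k m) (u≢v : u ≢ v) (pᵤ : p u ≡ nothing) (pᵥ : p v ≡ nothing) where

  private
    p′ᵤ : pinAt v a p u ≡ nothing
    p′ᵤ = trans (pinAt-other a p u≢v) pᵤ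

  pinPair-other : ∀ {j} → j ≢ u → j ≢ v → pinPair u v a p j ≡ p j
  pinPair-other j≢u j≢v = trans (pinAt-other a (pinAt v a p) j≢u) (pinAt-other a p j≢v)

  load-pinPair : ∀ x → load (pinPair u v a p) x ≡ 2 * 𝟙 (does (a ≟ x)) + load p x
  load-pinPair x = begin
    load (pinPair u v a p) x                           ≡⟨ load-pinAt u a (pinAt v a p) p′ᵤ x ⟩
    𝟙 (does (a ≟ x)) + load (pinAt v a p) x            ≡⟨ cong (𝟙 (does (a ≟ x)) +_) (load-pinAt v a p pᵥ x) ⟩
    𝟙 (does (a ≟ x)) + (𝟙 (does (a ≟ x)) + load p x)   ≡⟨ twice (𝟙 (does (a ≟ x))) (load p x) ⟩
    2 * 𝟙 (does (a ≟ x)) + load p x                    ∎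
    where
    open ≡-Reasoning
    twice : ∀ b l → b + (b + l) ≡ 2 * b + l
    twice = solve-∀

  free-pinPair : free (pinPair u v a p) + 2 ≡ free p
  free-pinPair = begin
    free (pinPair u v a p) + 2                         ≡⟨ +-assoc (free (pinPair u v a p)) 1 1 ⟨
    free (pinPair u v a p) + 1 + 1                     ≡⟨ cong (_+ 1) (free-pinAt u a (pinAt v a p) p′ᵤ) ⟩
    free (pinAt v a p) + 1                             ≡⟨ free-pinAt v a p pᵥ ⟩
    free p                                             ∎
    where open ≡-Reasoning

  𝟙-respectsᵇ-pinPair : ∀ f → 𝟙 (respectsᵇ (pinPair u v a p) f) ≡ δ f u a * δ f v a * 𝟙 (respectsᵇ p f)
  𝟙-respectsᵇ-pinPair f = begin
    𝟙 (respectsᵇ (pinPair u v a p) f)                  ≡⟨ 𝟙-respectsᵇ-pinAt u a (pinAt v a p) p′ᵤ f ⟩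
    δ f u a * 𝟙 (respectsᵇ (pinAt v a p) f)            ≡⟨ cong (δ f u a *_) (𝟙-respectsᵇ-pinAt v a p pᵥ f) ⟩
    δ f u a * (δ f v a * 𝟙 (respectsᵇ p f))            ≡⟨ *-assoc (δ f u a) _ _ ⟨
    δ f u a * δ f v a * 𝟙 (respectsᵇ p f)              ∎
    where open ≡-Reasoning

mono₀ mono₁ mono₂ : ℕ → Monomial
mono₀ N = replicate N 1
mono₁ N = 2 ∷ replicate (N ∸ 2) 1
mono₂ N = 2 ∷ 2 ∷ replicate (N ∸ 4) 1

lookup-ones : ∀ r (x : Fin (length (replicate r 1))) → List.lookup (replicate r 1) x ≡ 1
lookup-ones (suc r) zero = refl
lookup-ones (suc r) (suc x) = lookup-ones r x

∑-ones : ∀ r → sum (List.lookup (replicate r 1)) ≡ r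
∑-ones zero = refl
∑-ones (suc r) = cong suc (∑-ones r)

∏-ones! : ∀ r → ∏ (λ x → List.lookup (replicate r 1) x !) ≡ 1
∏-ones! zero = refl
∏-ones! (suc r) = trans (+-identityʳ _) (∏-ones! r)

∑-mono₀ : ∀ N → sum (List.lookup (mono₀ N)) ≡ N
∑-mono₀ = ∑-ones

∑-mono₁ : ∀ N → 2 ≤ N → sum (List.lookup (mono₁ N)) ≡ N
∑-mono₁ N 2≤N = trans (cong (2 +_) (∑-ones (N ∸ 2))) (m+[n∸m]≡n 2≤N)

∑-mono₂ : ∀ N → 4 ≤ N → sum (List.lookup (mono₂ N)) ≡ N
∑-mono₂ N 4≤N = trans (cong (4 +_) (∑-ones (N ∸ 4))) (m+[n∸m]≡n 4≤N)

count-unpinned : ∀ {k} N (c : Fin k → ℕ) {K} → ∏ (λ x → c x !) ≡ K → sum c ≡ N → K * count (ones N) noPins c ≡ N !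
count-unpinned {k} N c refl total = trans
  (multinomial N noPins c c (λ x → cong (_+ c x) (load-noPins N x)) (trans total (sym (free-noPins {k} N))))
  (cong _! (free-noPins {k} N))

count-mono₀ : ∀ N → count (ones N) noPins (List.lookup (mono₀ N)) ≡ N !
count-mono₀ N = trans (sym (*-identityˡ _)) (count-unpinned N _ (∏-ones! N) (∑-mono₀ N))

count-mono₁ : ∀ N → 2 ≤ N → 2 * count (ones N) noPins (List.lookup (mono₁ N)) ≡ N !
count-mono₁ N 2≤N = count-unpinned N _ (cong (2 *_) (∏-ones! (N ∸ 2))) (∑-mono₁ N 2≤N)

count-mono₂ : ∀ N → 4 ≤ N → 4 * count (ones N) noPins (List.lookup (mono₂ N)) ≡ N !
count-mono₂ N 4≤N = count-unpinned N _ (cong (λ r → 2 * (2 * r)) (∏-ones! (N ∸ 4))) (∑-mono₂ N 4≤N)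

count-pinned : ∀ {k} N (p : Pins k N) (c d : Fin k → ℕ) {K F} → (∀ x → load p x + d x ≡ c x) →
  sum d ≡ F → free p ≡ F → ∏ (λ x → d x !) ≡ K → K * count (ones N) p c ≡ F !
count-pinned N p c d split refl free≡ refl = trans (multinomial N p c d split (sym free≡)) (cong _! free≡)

module _ {N : ℕ} {u v : Fin N} (u≢v : u ≢ v) where

  load-pair : ∀ {k} (a : Fin k) x → load (pinPair u v a noPins) x ≡ 2 * 𝟙 (does (a ≟ x)) + 0
  load-pair a x = trans (load-pinPair a noPins u≢v refl refl x) (cong (2 * 𝟙 (does (a ≟ x)) +_) (load-noPins N x))

  free-pair : ∀ {k} (a : Fin k) → free (pinPair u v a noPins) ≡ N ∸ 2
  free-pair {k} a = trans (sym (m+n∸n≡m _ 2)) (cong (_∸ 2) (trans (free-pinPair a noPins u≢v refl refl) (free-noPins {k} N)))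

  count-pair-mono₁ : count (ones N) (pinPair u v zero noPins) (List.lookup (mono₁ N)) ≡ (N ∸ 2) !
  count-pair-mono₁ = trans (sym (*-identityˡ _))
    (count-pinned N _ _ d (λ x → trans (cong (_+ d x) (load-pair zero x)) (split x)) (∑-ones (N ∸ 2)) (free-pair zero) (trans (+-identityʳ _) (∏-ones! (N ∸ 2))))
    where
    d = List.lookup (0 ∷ replicate (N ∸ 2) 1)
    split : ∀ x → 2 * 𝟙 (does (zero ≟ x)) + 0 + d x ≡ List.lookup (mono₁ N) x
    split zero = refl
    split (suc x) = refl

  module _ (4≤N : 4 ≤ N) where

    N∸2≡2+N∸4 : N ∸ 2 ≡ 2 + (N ∸ 4)
    N∸2≡2+N∸4 = cong (_∸ 2) (sym (m+[n∸m]≡n 4≤N))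

    count-pair-mono₂-first : 2 * count (ones N) (pinPair u v zero noPins) (List.lookup (mono₂ N)) ≡ (N ∸ 2) !
    count-pair-mono₂-first = count-pinned N _ _ d (λ x → trans (cong (_+ d x) (load-pair zero x)) (split x))
      (trans (cong (2 +_) (∑-ones (N ∸ 4))) (sym N∸2≡2+N∸4)) (free-pair zero) (cong (λ r → 1 * (2 * r)) (∏-ones! (N ∸ 4)))
      where
      d = List.lookup (0 ∷ 2 ∷ replicate (N ∸ 4) 1)
      split : ∀ x → 2 * 𝟙 (does (zero ≟ x)) + 0 + d x ≡ List.lookup (mono₂ N) x
      split zero = refl
      split (suc zero) = refl
      split (suc (suc x)) = refl

    count-pair-mono₂-second : 2 * count (ones N) (pinPair u v (suc zero) noPins) (List.lookup (mono₂ N)) ≡ (N ∸ 2) !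
    count-pair-mono₂-second = count-pinned N _ _ d (λ x → trans (cong (_+ d x) (load-pair (suc zero) x)) (split x))
      (trans (cong (2 +_) (∑-ones (N ∸ 4))) (sym N∸2≡2+N∸4)) (free-pair (suc zero)) (cong (λ r → 2 * (1 * r)) (∏-ones! (N ∸ 4)))
      where
      d = List.lookup (2 ∷ 0 ∷ replicate (N ∸ 4) 1)
      split : ∀ x → 2 * 𝟙 (does (suc zero ≟ x)) + 0 + d x ≡ List.lookup (mono₂ N) x
      split zero = refl
      split (suc zero) = refl
      split (suc (suc x)) = refl

module _ {N : ℕ} {v₁ v₂ v₃ v₄ : Fin N} (v₁≢v₂ : v₁ ≢ v₂) (v₃≢v₄ : v₃ ≢ v₄)
         (v₁≢v₃ : v₁ ≢ v₃) (v₁≢v₄ : v₁ ≢ v₄) (v₂≢v₃ : v₂ ≢ v₃) (v₂≢v₄ : v₂ ≢ v₄) where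

  private
    inner : Pins (length (mono₂ N)) N
    inner = pinPair v₃ v₄ (suc zero) noPins

  pinTwoPairs : Pins (length (mono₂ N)) N
  pinTwoPairs = pinPair v₁ v₂ zero inner

  private
    inner-v₁ : inner v₁ ≡ nothing
    inner-v₁ = pinPair-other (suc zero) noPins v₃≢v₄ refl refl v₁≢v₃ v₁≢v₄
    inner-v₂ : inner v₂ ≡ nothing
    inner-v₂ = pinPair-other (suc zero) noPins v₃≢v₄ refl refl v₂≢v₃ v₂≢v₄

  𝟙-respectsᵇ-pinTwoPairs : ∀ κ → 𝟙 (respectsᵇ pinTwoPairs κ) ≡
    δ κ v₁ zero * δ κ v₂ zero * (δ κ v₃ (suc zero) * δ κ v₄ (suc zero) * 1)
  𝟙-respectsᵇ-pinTwoPairs κ = trans (𝟙-respectsᵇ-pinPair zero inner v₁≢v₂ inner-v₁ inner-v₂ κ)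
    (cong (δ κ v₁ zero * δ κ v₂ zero *_) (trans (𝟙-respectsᵇ-pinPair (suc zero) noPins v₃≢v₄ refl refl κ)
      (cong (λ b → δ κ v₃ (suc zero) * δ κ v₄ (suc zero) * 𝟙 b) (respectsᵇ-noPins κ))))

  free-pinTwoPairs : free pinTwoPairs + 4 ≡ N
  free-pinTwoPairs = begin
    free pinTwoPairs + 4          ≡⟨ +-assoc (free pinTwoPairs) 2 2 ⟨
    free pinTwoPairs + 2 + 2      ≡⟨ cong (_+ 2) (free-pinPair zero inner v₁≢v₂ inner-v₁ inner-v₂) ⟩
    free inner + 2                ≡⟨ free-pinPair (suc zero) noPins v₃≢v₄ refl refl ⟩
    free {length (mono₂ N)} {N} noPins ≡⟨ free-noPins {length (mono₂ N)} N ⟩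
    N                             ∎
    where open ≡-Reasoning

  two-pairs⇒4≤N : 4 ≤ N
  two-pairs⇒4≤N = subst (4 ≤_) free-pinTwoPairs (m≤n+m 4 _)

  count-pinTwoPairs-mono₂ : count (ones N) pinTwoPairs (List.lookup (mono₂ N)) ≡ (N ∸ 4) !
  count-pinTwoPairs-mono₂ = trans (sym (*-identityˡ _))
    (count-pinned N _ _ d (λ x → trans (cong (_+ d x) (load≡ x)) (split x))
      (∑-ones (N ∸ 4)) (trans (sym (m+n∸n≡m _ 4)) (cong (_∸ 4) free-pinTwoPairs)) (trans (+-identityʳ _) (trans (+-identityʳ _) (∏-ones! (N ∸ 4)))))
    where
    d = List.lookup (0 ∷ 0 ∷ replicate (N ∸ 4) 1)
    load≡ : ∀ x → load pinTwoPairs x ≡ 2 * 𝟙 (does (zero ≟ x)) + (2 * 𝟙 (does (suc zero ≟ x)) + 0)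
    load≡ x = trans (load-pinPair zero inner v₁≢v₂ inner-v₁ inner-v₂ x)
      (cong (2 * 𝟙 (does (zero ≟ x)) +_) (load-pair v₃≢v₄ (suc zero) x))
    split : ∀ x → 2 * 𝟙 (does (zero ≟ x)) + (2 * 𝟙 (does (suc zero ≟ x)) + 0) + d x ≡ List.lookup (mono₂ N) x
    split zero = refl
    split (suc zero) = refl
    split (suc (suc x)) = refl

-- Monochromatic edges

classSize : ∀ {k m} → Vec (Fin k) m → Fin k → ℕ
classSize {m = m} κ x = ∑[ u < m ] δ κ u x

weightAt-ones : ∀ {k m} (κ : Vec (Fin k) m) x → weightAt x κ (ones m) ≡ classSize κ x
weightAt-ones [] x = refl
weightAt-ones (y ∷ κ) x = cong (𝟙 (does (y ≟ x)) +_) (weightAt-ones κ x)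

δ≤1 : ∀ {k m} (κ : Vec (Fin k) m) u x → δ κ u x ≤ 1
δ≤1 κ u x with does (lookup κ u ≟ x)
... | true = ≤-refl
... | false = z≤n

∑∑-symmetric-even : ∀ {m} (f : Fin m → Fin m → ℕ) → (∀ u v → f u v ≡ f v u) → (∀ u → f u u ≡ 0) →
  ∃[ h ] ∑[ u < m ] ∑[ v < m ] f u v ≡ h + h
∑∑-symmetric-even {zero} f _ _ = 0 , refl
∑∑-symmetric-even {suc m} f symm diag with ∑∑-symmetric-even (λ u v → f (suc u) (suc v)) (λ u v → symm _ _) (diag ∘ suc)
... | h , inner≡h+h = row + h , (begin
  f₀₀ + row + ∑[ u < m ] (f (suc u) zero + ∑[ v < m ] f (suc u) (suc v))
      ≡⟨ cong₂ (λ a b → a + row + b) (diag zero) (∑-distrib-+ (λ u → f (suc u) zero) _) ⟩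
  0 + row + (∑[ u < m ] f (suc u) zero + ∑[ u < m ] ∑[ v < m ] f (suc u) (suc v))
      ≡⟨ cong₂ (λ a b → 0 + row + (a + b)) (sum-cong-≗ (λ u → symm (suc u) zero)) inner≡h+h ⟩
  0 + row + (row + (h + h))
      ≡⟨ regroup row h ⟩
  row + h + (row + h) ∎)
  where
  open ≡-Reasoning
  f₀₀ = f zero zero
  row = ∑[ v < m ] f zero (suc v)
  regroup : ∀ r h → 0 + r + (r + (h + h)) ≡ r + h + (r + h)
  regroup = solve-∀

adjacent⇒≢ : ∀ G {u v} → adj G u v ≡ true → u ≢ v
adjacent⇒≢ G {u} edge refl with trans (sym edge) (irrefl G u)
... | ()

module _ (G : Graph) where

  private
    N = n G
    A = adj G

  monoEdges : ∀ {k} → Vec (Fin k) N → Fin k → ℕ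
  monoEdges κ x = ∑[ u < N ] ∑[ v < N ] (𝟙 (A u v) * (δ κ u x * δ κ v x))

  monoEdges-even : ∀ {k} (κ : Vec (Fin k) N) x → ∃[ h ] monoEdges κ x ≡ h + h
  monoEdges-even κ x = ∑∑-symmetric-even _
    (λ u v → cong₂ (λ a b → 𝟙 a * b) (Graph.sym G u v) (*-comm (δ κ u x) (δ κ v x)))
    (λ u → cong (λ a → 𝟙 a * (δ κ u x * δ κ u x)) (irrefl G u))

  neighbours-in-class : ∀ {k} (κ : Vec (Fin k) N) x u → ∑[ v < N ] (𝟙 (A u v) * δ κ v x) + δ κ u x ≤ classSize κ x
  neighbours-in-class κ x u = begin
    ∑[ v < N ] (𝟙 (A u v) * δ κ v x) + δ κ u x       ≤⟨ +-monoˡ-≤ (δ κ u x) (∑-mono off-u) ⟩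
    sum (lower δₓ u (δₓ u)) + δₓ u                   ≡⟨ ∑-lower δₓ u (δₓ u) ≤-refl ⟩
    classSize κ x                                    ∎
    where
    open ≤-Reasoning
    δₓ = λ v → δ κ v x
    off-u : ∀ v → 𝟙 (A u v) * δ κ v x ≤ lower δₓ u (δₓ u) v
    off-u v with u ≟ v
    ... | yes refl rewrite irrefl G u = z≤n
    ... | no _ = ≤-trans (*-monoˡ-≤ (δ κ v x) (𝟙≤1 (A u v))) (≤-reflexive (+-identityʳ _))

  monoEdges-≤ : ∀ {k} (κ : Vec (Fin k) N) x → monoEdges κ x ≤ classSize κ x * (classSize κ x ∸ 1)
  monoEdges-≤ κ x = begin
    monoEdges κ x
        ≡⟨ sum-cong-≗ (λ u → trans (sum-cong-≗ (λ v → regroup (𝟙 (A u v)) (δ κ u x) (δ κ v x)))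
                                   (∑-*ˡ (δ κ u x) (λ v → 𝟙 (A u v) * δ κ v x))) ⟩
    ∑[ u < N ] (δ κ u x * ∑[ v < N ] (𝟙 (A u v) * δ κ v x))
                                                   ≤⟨ ∑-mono (λ u → guarded (δ≤1 κ u x) (neighbours-in-class κ x u)) ⟩
    ∑[ u < N ] (δ κ u x * (classSize κ x ∸ 1))     ≡⟨ ∑-*ʳ (classSize κ x ∸ 1) (λ u → δ κ u x) ⟩
    classSize κ x * (classSize κ x ∸ 1)            ∎
    where
    open ≤-Reasoning
    regroup : ∀ a b c → a * (b * c) ≡ b * (a * c)
    regroup = solve-∀
    guarded : ∀ {b t s} → b ≤ 1 → t + b ≤ s → b * t ≤ b * (s ∸ 1)
    guarded {zero} _ _ = z≤n
    guarded {suc zero} {t} {s} _ t+1≤s = *-monoʳ-≤ 1 (subst (_≤ s ∸ 1) (m+n∸n≡m t 1) (∸-monoˡ-≤ 1 t+1≤s))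
    guarded {suc (suc _)} (s≤s ()) _

  monoEdges-small : ∀ {k} (κ : Vec (Fin k) N) x → classSize κ x ≤ 1 → monoEdges κ x ≡ 0
  monoEdges-small κ x s≤1 = n≤0⇒n≡0 (≤-trans (monoEdges-≤ κ x) (≤-reflexive (s[s-1]≡0 (classSize κ x) s≤1)))
    where
    s[s-1]≡0 : ∀ s → s ≤ 1 → s * (s ∸ 1) ≡ 0
    s[s-1]≡0 zero _ = refl
    s[s-1]≡0 (suc zero) _ = refl
    s[s-1]≡0 (suc (suc _)) (s≤s ())

  monoEdges-pair : ∀ {k} (κ : Vec (Fin k) N) x → classSize κ x ≡ 2 → monoEdges κ x ≡ 0 ⊎ monoEdges κ x ≡ 2
  monoEdges-pair κ x s≡2 with monoEdges-even κ x
  ... | h , M≡h+h = even≤2 h M≡h+h (subst (_≤ 2) M≡h+h (subst (λ s → monoEdges κ x ≤ s * (s ∸ 1)) s≡2 (monoEdges-≤ κ x)))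
    where
    even≤2 : ∀ h → monoEdges κ x ≡ h + h → h + h ≤ 2 → monoEdges κ x ≡ 0 ⊎ monoEdges κ x ≡ 2
    even≤2 zero M≡0 _ = inj₁ M≡0
    even≤2 (suc zero) M≡2 _ = inj₂ M≡2
    even≤2 (suc (suc h)) _ (s≤s (s≤s h+2+h≤0)) = ⊥-elim (n≮0 (subst (_≤ 0) (+-suc h (suc h)) h+2+h≤0))

  private
    properPair : ∀ {k} → Vec (Fin k) N → Fin N → Fin N → Bool
    properPair κ u v = not (A u v) ∨ not (does (lookup κ u ≟ lookup κ v))

    term≤monoEdges : ∀ {k} (κ : Vec (Fin k) N) x u v → 𝟙 (A u v) * (δ κ u x * δ κ v x) ≤ monoEdges κ x
    term≤monoEdges κ x u v = ≤-trans (term≤∑ _ v) (term≤∑ (λ u → ∑[ v < N ] (𝟙 (A u v) * (δ κ u x * δ κ v x))) u)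

  edge≤monoEdges : ∀ {k} (κ : Vec (Fin k) N) x {u v} → A u v ≡ true → δ κ u x * δ κ v x ≤ monoEdges κ x
  edge≤monoEdges κ x {u} {v} edge = subst (_≤ monoEdges κ x) (trans (cong (λ b → 𝟙 b * (δ κ u x * δ κ v x)) edge) (+-identityʳ _))
    (term≤monoEdges κ x u v)

  proper⇒monoEdges≡0 : ∀ {k} (κ : Vec (Fin k) N) → T (proper G κ) → ∀ x → monoEdges κ x ≡ 0
  proper⇒monoEdges≡0 κ t x = trans (sum-cong-≗ (λ u → trans (sum-cong-≗ (λ v → term≡0 u v)) (∑-zero N))) (∑-zero N)
    where
    term≡0 : ∀ u v → 𝟙 (A u v) * (δ κ u x * δ κ v x) ≡ 0
    term≡0 u v with T-allᵇ-tabulate⁻ (properPair κ u) id (T-allᵇ-tabulate⁻ _ id t u) v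
    ... | pair with A u v
    ... | false = refl
    ... | true with lookup κ u ≟ x | lookup κ v ≟ x
    ...   | yes refl | yes κᵥ≡x with lookup κ u ≟ lookup κ v
    ...     | yes _ = ⊥-elim pair
    ...     | no κᵤ≢κᵥ = ⊥-elim (κᵤ≢κᵥ (sym κᵥ≡x))
    term≡0 u v | _ | true | yes _ | no _ = refl
    term≡0 u v | _ | true | no _ | _ = refl

  monoEdges≡0⇒proper : ∀ {k} (κ : Vec (Fin k) N) → (∀ x → monoEdges κ x ≡ 0) → T (proper G κ)
  monoEdges≡0⇒proper κ none = T-allᵇ-tabulate⁺ _ id (λ u → T-allᵇ-tabulate⁺ (properPair κ u) id (pair u))
    where
    pair : ∀ u v → T (properPair κ u v)
    pair u v with A u v in edge
    ... | false = tt
    ... | true with lookup κ u ≟ lookup κ v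
    ...   | no _ = tt
    ...   | yes κᵤ≡κᵥ = ⊥-elim (n≮0 (subst (1 ≤_) (none (lookup κ u)) (subst (_≤ monoEdges κ (lookup κ u)) term≡1 (term≤monoEdges κ (lookup κ u) u v))))
      where
      δ-self : ∀ w → lookup κ w ≡ lookup κ u → δ κ w (lookup κ u) ≡ 1
      δ-self w eq with lookup κ w ≟ lookup κ u
      ... | yes _ = refl
      ... | no ne = ⊥-elim (ne eq)
      term≡1 : 𝟙 (A u v) * (δ κ u (lookup κ u) * δ κ v (lookup κ u)) ≡ 1
      term≡1 rewrite edge | δ-self u refl | δ-self v (sym κᵤ≡κᵥ) = refl

  module _ {k} (c : Fin k → ℕ) (κ : Vec (Fin k) N) (content : T (contentᵇ c (ones N) κ)) where

    private
      classSize≡ : ∀ x → classSize κ x ≡ c x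
      classSize≡ x = trans (sym (weightAt-ones κ x)) (contentᵇ⁻ c (ones N) κ content x)

      small : ∀ x → c x ≤ 1 → monoEdges κ x ≡ 0
      small x cₓ≤1 = monoEdges-small κ x (subst (_≤ 1) (sym (classSize≡ x)) cₓ≤1)

      pair : ∀ z → c z ≡ 2 → monoEdges κ z ≡ 0 ⊎ monoEdges κ z ≡ 2
      pair z c₂≡2 = monoEdges-pair κ z (trans (classSize≡ z) c₂≡2)

      proper! : (∀ x → monoEdges κ x ≡ 0) → 𝟙 (proper G κ) ≡ 1
      proper! none = T⇒𝟙≡1 (monoEdges≡0⇒proper κ none)

      improper! : ∀ x → monoEdges κ x ≡ 2 → 𝟙 (proper G κ) ≡ 0
      improper! x M≡2 = ¬T⇒𝟙≡0 (λ t → 0≢1+n (trans (sym (proper⇒monoEdges≡0 κ t x)) M≡2))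

      none₁ : ∀ z → (∀ x → x ≢ z → c x ≤ 1) → monoEdges κ z ≡ 0 → ∀ x → monoEdges κ x ≡ 0
      none₁ z others≤1 M≡0 x with x ≟ z
      ... | yes refl = M≡0
      ... | no x≢z = small x (others≤1 x x≢z)

      none₂ : ∀ z₀ z₁ → (∀ x → x ≢ z₀ → x ≢ z₁ → c x ≤ 1) → monoEdges κ z₀ ≡ 0 → monoEdges κ z₁ ≡ 0 → ∀ x → monoEdges κ x ≡ 0
      none₂ z₀ z₁ others≤1 M₀≡0 M₁≡0 x with x ≟ z₀ | x ≟ z₁
      ... | yes refl | _ = M₀≡0
      ... | no _ | yes refl = M₁≡0
      ... | no x≢z₀ | no x≢z₁ = small x (others≤1 x x≢z₀ x≢z₁)

    local-identity₀ : (∀ x → c x ≤ 1) → 𝟙 (proper G κ) ≡ 1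
    local-identity₀ all≤1 = proper! (λ x → small x (all≤1 x))

    local-identity₁ : ∀ z → c z ≡ 2 → (∀ x → x ≢ z → c x ≤ 1) → 2 * 𝟙 (proper G κ) + monoEdges κ z ≡ 2
    local-identity₁ z c₂≡2 others≤1 with pair z c₂≡2
    ... | inj₂ M≡2 rewrite improper! z M≡2 | M≡2 = refl
    ... | inj₁ M≡0 rewrite proper! (none₁ z others≤1 M≡0) | M≡0 = refl

    local-identity₂ : ∀ z₀ z₁ → c z₀ ≡ 2 → c z₁ ≡ 2 → (∀ x → x ≢ z₀ → x ≢ z₁ → c x ≤ 1) →
      4 * 𝟙 (proper G κ) + 2 * monoEdges κ z₀ + 2 * monoEdges κ z₁ ≡ 4 + monoEdges κ z₀ * monoEdges κ z₁
    local-identity₂ z₀ z₁ c₀≡2 c₁≡2 others≤1 with pair z₀ c₀≡2 | pair z₁ c₁≡2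
    ... | inj₂ M₀≡2 | inj₁ M₁≡0 rewrite improper! z₀ M₀≡2 | M₀≡2 | M₁≡0 = refl
    ... | inj₂ M₀≡2 | inj₂ M₁≡2 rewrite improper! z₀ M₀≡2 | M₀≡2 | M₁≡2 = refl
    ... | inj₁ M₀≡0 | inj₂ M₁≡2 rewrite improper! z₁ M₁≡2 | M₀≡0 | M₁≡2 = refl
    ... | inj₁ M₀≡0 | inj₁ M₁≡0 rewrite proper! (none₂ z₀ z₁ others≤1 M₀≡0 M₁≡0) | M₀≡0 | M₁≡0 = refl

-- Three coefficients of X_G

module _ (G : Graph) where

  private
    N = n G
    A = adj G

  ∑content : ∀ {k} → (Fin k → ℕ) → (Vec (Fin k) N → ℕ) → ℕ
  ∑content c F = ∑ᵛ (λ κ → 𝟙 (contentᵇ c (ones N) κ) * F κ)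

  ∑content-cong : ∀ {k} (c : Fin k → ℕ) {F F′ : Vec (Fin k) N → ℕ} → (∀ κ → T (contentᵇ c (ones N) κ) → F κ ≡ F′ κ) →
    ∑content c F ≡ ∑content c F′
  ∑content-cong c F≡F′ = ∑ᵛ-cong pointwise
    where
    pointwise : ∀ κ → 𝟙 (contentᵇ c (ones N) κ) * _ ≡ 𝟙 (contentᵇ c (ones N) κ) * _
    pointwise κ with contentᵇ c (ones N) κ in content
    ... | true = cong (_+ 0) (F≡F′ κ (subst T (sym content) tt))
    ... | false = refl

  ∑content-+ : ∀ {k} (c : Fin k → ℕ) F F′ → ∑content c (λ κ → F κ + F′ κ) ≡ ∑content c F + ∑content c F′
  ∑content-+ c F F′ = trans (∑ᵛ-cong (λ κ → *-distribˡ-+ (𝟙 (contentᵇ c (ones N) κ)) (F κ) (F′ κ)))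
    (∑ᵛ-+ (λ κ → 𝟙 (contentᵇ c (ones N) κ) * F κ) (λ κ → 𝟙 (contentᵇ c (ones N) κ) * F′ κ))

  ∑content-*ˡ : ∀ {k} (c : Fin k → ℕ) a F → ∑content c (λ κ → a * F κ) ≡ a * ∑content c F
  ∑content-*ˡ c a F = trans (∑ᵛ-cong (λ κ → swap (𝟙 (contentᵇ c (ones N) κ)) a (F κ))) (∑ᵛ-*ˡ a (λ κ → 𝟙 (contentᵇ c (ones N) κ) * F κ))
    where
    swap : ∀ x a f → x * (a * f) ≡ a * (x * f)
    swap = solve-∀

  ∑content-mono : ∀ {k} (c : Fin k → ℕ) {F F′ : Vec (Fin k) N → ℕ} → (∀ κ → F κ ≤ F′ κ) → ∑content c F ≤ ∑content c F′
  ∑content-mono c F≤F′ = ∑ᵛ-mono (λ κ → *-monoʳ-≤ (𝟙 (contentᵇ c (ones N) κ)) (F≤F′ κ))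

  ∑content≡count : ∀ {k} (c : Fin k → ℕ) p → ∑content c (λ κ → 𝟙 (respectsᵇ p κ)) ≡ count (ones N) p c
  ∑content≡count c p = ∑ᵛ-cong (λ κ → sym (𝟙-∧ (contentᵇ c (ones N) κ) (respectsᵇ p κ)))

  ∑content-1 : ∀ {k} (c : Fin k → ℕ) → ∑content c (λ _ → 1) ≡ count (ones N) noPins c
  ∑content-1 c = trans (∑content-cong c (λ κ _ → cong 𝟙 (sym (respectsᵇ-noPins κ)))) (∑content≡count c noPins)

  ∑content-pinPair : ∀ {k} (c : Fin k → ℕ) (p : Pins k N) {u v} a → u ≢ v → p u ≡ nothing → p v ≡ nothing →
    ∑content c (λ κ → δ κ u a * δ κ v a * 𝟙 (respectsᵇ p κ)) ≡ count (ones N) (pinPair u v a p) c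
  ∑content-pinPair c p a u≢v pᵤ pᵥ =
    trans (∑content-cong c (λ κ _ → sym (𝟙-respectsᵇ-pinPair a p u≢v pᵤ pᵥ κ))) (∑content≡count c _)

  ∑content-pair : ∀ {k} (c : Fin k → ℕ) {u v} a → u ≢ v →
    ∑content c (λ κ → δ κ u a * δ κ v a) ≡ count (ones N) (pinPair u v a noPins) c
  ∑content-pair c {u} {v} a u≢v = trans
    (∑content-cong c (λ κ _ → trans (sym (*-identityʳ _)) (cong (λ b → δ κ u a * δ κ v a * 𝟙 b) (sym (respectsᵇ-noPins κ)))))
    (∑content-pinPair c noPins a u≢v refl refl)

  ∑content-monoEdges : ∀ {k} (c : Fin k → ℕ) x →
    ∑content c (λ κ → monoEdges G κ x) ≡ ∑[ u < N ] ∑[ v < N ] (𝟙 (A u v) * ∑content c (λ κ → δ κ u x * δ κ v x))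
  ∑content-monoEdges c x = begin
    ∑ᵛ (λ κ → 𝟙C κ * monoEdges G κ x)                               ≡⟨ ∑ᵛ-cong distribute ⟩
    ∑ᵛ (λ κ → ∑[ u < N ] ∑[ v < N ] (𝟙 (A u v) * (𝟙C κ * δδ κ u v)))
        ≡⟨ ∑ᵛ-∑-comm (λ κ u → ∑[ v < N ] (𝟙 (A u v) * (𝟙C κ * δδ κ u v))) ⟩
    ∑[ u < N ] ∑ᵛ (λ κ → ∑[ v < N ] (𝟙 (A u v) * (𝟙C κ * δδ κ u v)))
        ≡⟨ sum-cong-≗ (λ u → ∑ᵛ-∑-comm (λ κ v → 𝟙 (A u v) * (𝟙C κ * δδ κ u v))) ⟩
    ∑[ u < N ] ∑[ v < N ] ∑ᵛ (λ κ → 𝟙 (A u v) * (𝟙C κ * δδ κ u v))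
        ≡⟨ sum-cong-≗ (λ u → sum-cong-≗ (λ v → ∑ᵛ-*ˡ (𝟙 (A u v)) (λ κ → 𝟙C κ * δδ κ u v))) ⟩
    ∑[ u < N ] ∑[ v < N ] (𝟙 (A u v) * ∑content c (λ κ → δδ κ u v))  ∎
    where
    open ≡-Reasoning
    𝟙C = λ κ → 𝟙 (contentᵇ c (ones N) κ)
    δδ = λ κ u v → δ κ u x * δ κ v x
    swap : ∀ a b f → a * (b * f) ≡ b * (a * f)
    swap = solve-∀
    distribute : ∀ κ → 𝟙C κ * monoEdges G κ x ≡ ∑[ u < N ] ∑[ v < N ] (𝟙 (A u v) * (𝟙C κ * δδ κ u v))
    distribute κ = trans (sym (∑-*ˡ (𝟙C κ) (λ u → ∑[ v < N ] (𝟙 (A u v) * δδ κ u v))))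
      (sum-cong-≗ (λ u → trans (sym (∑-*ˡ (𝟙C κ) (λ v → 𝟙 (A u v) * δδ κ u v)))
                               (sum-cong-≗ (λ v → swap (𝟙C κ) (𝟙 (A u v)) (δδ κ u v)))))

  edgeWeight : ℕ
  edgeWeight = ∑[ u < N ] ∑[ v < N ] (𝟙 (A u v) * (N ∸ 2) !)

  ∑content-monoEdges≡edgeWeight : ∀ {k} (c : Fin k → ℕ) x K →
    (∀ u v → u ≢ v → K * ∑content c (λ κ → δ κ u x * δ κ v x) ≡ (N ∸ 2) !) →
    K * ∑content c (λ κ → monoEdges G κ x) ≡ edgeWeight
  ∑content-monoEdges≡edgeWeight c x K pairs = begin
    K * ∑content c (λ κ → monoEdges G κ x)                      ≡⟨ cong (K *_) (∑content-monoEdges c x) ⟩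
    K * ∑[ u < N ] ∑[ v < N ] (𝟙 (A u v) * S u v)               ≡⟨ ∑-*ˡ K (λ u → ∑[ v < N ] (𝟙 (A u v) * S u v)) ⟨
    ∑[ u < N ] (K * ∑[ v < N ] (𝟙 (A u v) * S u v))             ≡⟨ sum-cong-≗ (λ u → sym (∑-*ˡ K (λ v → 𝟙 (A u v) * S u v))) ⟩
    ∑[ u < N ] ∑[ v < N ] (K * (𝟙 (A u v) * S u v))             ≡⟨ sum-cong-≗ (λ u → sum-cong-≗ (λ v → per-pair u v)) ⟩
    edgeWeight                                                  ∎
    where
    open ≡-Reasoning
    S = λ u v → ∑content c (λ κ → δ κ u x * δ κ v x)
    per-pair : ∀ u v → K * (𝟙 (A u v) * S u v) ≡ 𝟙 (A u v) * (N ∸ 2) !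
    per-pair u v with A u v in edge
    ... | false = *-zeroʳ K
    ... | true = trans (cong (K *_) (+-identityʳ _)) (trans (pairs u v (adjacent⇒≢ G edge)) (sym (+-identityʳ _)))

  properCount : Monomial → ℕ
  properCount α = ∑content (List.lookup α) (λ κ → 𝟙 (proper G κ))

  X≡properCount : ∀ α → X G α ≡ ℕtoℚ (properCount α)
  X≡properCount α = cong ℕtoℚ (trans (countᵇ-allVecs N (length α) _)
    (∑ᵛ-cong (λ κ → trans (𝟙-∧ (proper G κ) _) (*-comm (𝟙 (proper G κ)) _))))

  properCount-mono₀ : properCount (mono₀ N) ≡ N !
  properCount-mono₀ = begin
    properCount (mono₀ N)                         ≡⟨ ∑content-cong c (λ κ content → local-identity₀ G c κ content (λ x → ≤-reflexive (lookup-ones N x))) ⟩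
    ∑content c (λ _ → 1)                          ≡⟨ ∑content-1 c ⟩
    count (ones N) noPins c                       ≡⟨ count-mono₀ N ⟩
    N !                                           ∎
    where
    open ≡-Reasoning
    c = List.lookup (mono₀ N)

  private
    first : ∀ {r} → Fin (suc r)
    first = zero
    second : ∀ {r} → Fin (suc (suc r))
    second = suc zero

  properCount-mono₁ : 2 ≤ N → 2 * properCount (mono₁ N) + edgeWeight ≡ N !
  properCount-mono₁ 2≤N = begin
    2 * properCount (mono₁ N) + edgeWeight                              ≡⟨ cong₂ _+_ (∑content-*ˡ c 2 _) monoEdges-sum ⟨
    ∑content c (λ κ → 2 * 𝟙 (proper G κ)) + ∑content c (λ κ → monoEdges G κ first)
                                                                        ≡⟨ ∑content-+ c _ _ ⟨
    ∑content c (λ κ → 2 * 𝟙 (proper G κ) + monoEdges G κ first)         ≡⟨ ∑content-cong c (λ κ content → local-identity₁ G c κ content first refl others≤1) ⟩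
    ∑content c (λ _ → 2 * 1)                                            ≡⟨ ∑content-*ˡ c 2 (λ _ → 1) ⟩
    2 * ∑content c (λ _ → 1)                                            ≡⟨ cong (2 *_) (∑content-1 c) ⟩
    2 * count (ones N) noPins c                                         ≡⟨ count-mono₁ N 2≤N ⟩
    N !                                                                 ∎
    where
    open ≡-Reasoning
    c = List.lookup (mono₁ N)
    others≤1 : ∀ x → x ≢ first → c x ≤ 1
    others≤1 zero x≢first = ⊥-elim (x≢first refl)
    others≤1 (suc x) _ = ≤-reflexive (lookup-ones (N ∸ 2) x)
    monoEdges-sum : ∑content c (λ κ → monoEdges G κ first) ≡ edgeWeight
    monoEdges-sum = trans (sym (*-identityˡ _)) (∑content-monoEdges≡edgeWeight c first 1 (λ u v u≢v →
      trans (*-identityˡ _) (trans (∑content-pair c first u≢v) (count-pair-mono₁ u≢v))))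

  twoMonoEdges : ℕ
  twoMonoEdges = ∑content (List.lookup (mono₂ N)) (λ κ → monoEdges G κ first * monoEdges G κ second)

  properCount-mono₂ : 4 ≤ N → 4 * properCount (mono₂ N) + edgeWeight + edgeWeight ≡ N ! + twoMonoEdges
  properCount-mono₂ 4≤N = begin
    4 * properCount (mono₂ N) + edgeWeight + edgeWeight
        ≡⟨ cong₂ _+_ (cong₂ _+_ (∑content-*ˡ c 4 _) (monoEdges-sum first (λ u≢v → count-pair-mono₂-first u≢v 4≤N)))
                     (monoEdges-sum second (λ u≢v → count-pair-mono₂-second u≢v 4≤N)) ⟨
    ∑content c (λ κ → 4 * 𝟙 (proper G κ)) + ∑content c (λ κ → 2 * M₀ κ) + ∑content c (λ κ → 2 * M₁ κ)
        ≡⟨ cong (_+ ∑content c (λ κ → 2 * M₁ κ)) (∑content-+ c _ _) ⟨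
    ∑content c (λ κ → 4 * 𝟙 (proper G κ) + 2 * M₀ κ) + ∑content c (λ κ → 2 * M₁ κ)
        ≡⟨ ∑content-+ c _ _ ⟨
    ∑content c (λ κ → 4 * 𝟙 (proper G κ) + 2 * M₀ κ + 2 * M₁ κ)
        ≡⟨ ∑content-cong c (λ κ content → local-identity₂ G c κ content first second refl refl others≤1) ⟩
    ∑content c (λ κ → 4 * 1 + M₀ κ * M₁ κ)
        ≡⟨ ∑content-+ c _ _ ⟩
    ∑content c (λ _ → 4 * 1) + twoMonoEdges
        ≡⟨ cong (_+ twoMonoEdges) (trans (∑content-*ˡ c 4 (λ _ → 1)) (cong (4 *_) (∑content-1 c))) ⟩
    4 * count (ones N) noPins c + twoMonoEdges
        ≡⟨ cong (_+ twoMonoEdges) (count-mono₂ N 4≤N) ⟩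
    N ! + twoMonoEdges  ∎
    where
    open ≡-Reasoning
    c = List.lookup (mono₂ N)
    M₀ M₁ : Vec (Fin (length (mono₂ N))) N → ℕ
    M₀ κ = monoEdges G κ first
    M₁ κ = monoEdges G κ second
    others≤1 : ∀ x → x ≢ first → x ≢ second → c x ≤ 1
    others≤1 zero x≢first _ = ⊥-elim (x≢first refl)
    others≤1 (suc zero) _ x≢second = ⊥-elim (x≢second refl)
    others≤1 (suc (suc x)) _ _ = ≤-reflexive (lookup-ones (N ∸ 4) x)
    monoEdges-sum : ∀ a → (∀ {u v} (u≢v : u ≢ v) → 2 * count (ones N) (pinPair u v a noPins) c ≡ (N ∸ 2) !) →
      ∑content c (λ κ → 2 * monoEdges G κ a) ≡ edgeWeight
    monoEdges-sum a pair-count = trans (∑content-*ˡ c 2 _) (∑content-monoEdges≡edgeWeight c a 2 (λ u v u≢v →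
      trans (cong (2 *_) (∑content-pair c a u≢v)) (pair-count u≢v)))

  module _ {v₁ v₂ v₃ v₄ : Fin N} (e₁₂ : A v₁ v₂ ≡ true) (e₃₄ : A v₃ v₄ ≡ true)
           (v₁≢v₃ : v₁ ≢ v₃) (v₁≢v₄ : v₁ ≢ v₄) (v₂≢v₃ : v₂ ≢ v₃) (v₂≢v₄ : v₂ ≢ v₄) where

    private
      v₁≢v₂ = adjacent⇒≢ G e₁₂
      v₃≢v₄ = adjacent⇒≢ G e₃₄
      pins = pinTwoPairs v₁≢v₂ v₃≢v₄ v₁≢v₃ v₁≢v₄ v₂≢v₃ v₂≢v₄

    4≤order : 4 ≤ N
    4≤order = two-pairs⇒4≤N v₁≢v₂ v₃≢v₄ v₁≢v₃ v₁≢v₄ v₂≢v₃ v₂≢v₄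

    twoMonoEdges-≥ : (N ∸ 4) ! ≤ twoMonoEdges
    twoMonoEdges-≥ = begin
      (N ∸ 4) !                                  ≡⟨ count-pinTwoPairs-mono₂ v₁≢v₂ v₃≢v₄ v₁≢v₃ v₁≢v₄ v₂≢v₃ v₂≢v₄ ⟨
      count (ones N) pins c                      ≡⟨ ∑content≡count c pins ⟨
      ∑content c (λ κ → 𝟙 (respectsᵇ pins κ))   ≤⟨ ∑content-mono c bound ⟩
      twoMonoEdges                               ∎
      where
      open ≤-Reasoning
      c = List.lookup (mono₂ N)
      bound : ∀ κ → 𝟙 (respectsᵇ pins κ) ≤ monoEdges G κ first * monoEdges G κ second
      bound κ = subst (_≤ _) (sym (𝟙-respectsᵇ-pinTwoPairs v₁≢v₂ v₃≢v₄ v₁≢v₃ v₁≢v₄ v₂≢v₃ v₂≢v₄ κ))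
        (*-mono-≤ (edge≤monoEdges G κ first e₁₂) (≤-trans (≤-reflexive (*-identityʳ _)) (edge≤monoEdges G κ second e₃₄)))

    coefficient-relation : properCount (mono₀ N) + 4 * properCount (mono₂ N) ≡ 4 * properCount (mono₁ N) + twoMonoEdges
    coefficient-relation = combine (properCount (mono₀ N)) (properCount (mono₁ N)) (properCount (mono₂ N)) edgeWeight twoMonoEdges
      properCount-mono₀ (properCount-mono₁ (≤-trans (s≤s (s≤s z≤n)) 4≤order)) (properCount-mono₂ 4≤order)
      where
      combine : ∀ a b c q p {f} → a ≡ f → 2 * b + q ≡ f → 4 * c + q + q ≡ f + p → a + 4 * c ≡ 4 * b + p
      combine a b c q p refl refl ec = +-cancelʳ-≡ (q + q) _ _ (trans (shuffle₁ a c q) (trans (cong (a +_) ec) (shuffle₂ b q p)))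
        where
        shuffle₁ : ∀ a c q → a + 4 * c + (q + q) ≡ a + (4 * c + q + q)
        shuffle₁ = solve-∀
        shuffle₂ : ∀ b q p → 2 * b + q + (2 * b + q + p) ≡ 4 * b + p + (q + q)
        shuffle₂ = solve-∀

partWeights : (rs : List ℕ) → Vec ℕ (length rs)
partWeights rs = Vec.map suc (Vec.fromList rs)

pProd≡count : ∀ rs α → pProd rs α ≡ ℕtoℚ (count (partWeights rs) noPins (List.lookup α))
pProd≡count rs α = cong ℕtoℚ (trans (countᵇ-allVecs (length rs) (length α) _)
  (∑ᵛ-cong (λ f → cong 𝟙 (trans (sym (∧-identityʳ _)) (cong (contentᵇ (List.lookup α) (partWeights rs) f ∧_) (sym (respectsᵇ-noPins f)))))))

-- Partitions all of whose parts are 1 or 2, in the encoding r ↦ part r + 1.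

data OneTwo : List ℕ → Set where
  [] : OneTwo []
  one∷_ : ∀ {rs} → OneTwo rs → OneTwo (0 ∷ rs)
  two∷_ : ∀ {rs} → OneTwo rs → OneTwo (1 ∷ rs)

oneTwo? : ∀ rs → Dec (OneTwo rs)
oneTwo? [] = yes []
oneTwo? (zero ∷ rs) with oneTwo? rs
... | yes ot = yes (one∷ ot)
... | no ¬ot = no λ { (one∷ ot) → ¬ot ot }
oneTwo? (suc zero ∷ rs) with oneTwo? rs
... | yes ot = yes (two∷ ot)
... | no ¬ot = no λ { (two∷ ot) → ¬ot ot }
oneTwo? (suc (suc _) ∷ rs) = no λ ()

mult₁ mult₂ : List ℕ → ℕ
mult₁ [] = 0
mult₁ (zero ∷ rs) = suc (mult₁ rs)
mult₁ (suc _ ∷ rs) = mult₁ rs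
mult₂ [] = 0
mult₂ (zero ∷ rs) = mult₂ rs
mult₂ (suc _ ∷ rs) = suc (mult₂ rs)

degree-oneTwo : ∀ {rs} → OneTwo rs → Vec.sum (partWeights rs) ≡ mult₁ rs + 2 * mult₂ rs
degree-oneTwo [] = refl
degree-oneTwo (one∷ ot) = cong suc (degree-oneTwo ot)
degree-oneTwo {1 ∷ rs} (two∷ ot) = trans (cong (2 +_) (degree-oneTwo ot)) (shift (mult₁ rs) (mult₂ rs))
  where
  shift : ∀ a b → 2 + (a + 2 * b) ≡ a + 2 * suc b
  shift = solve-∀

sum-oneTwo : ∀ {rs} → OneTwo rs → sumℕ rs ≡ mult₂ rs
sum-oneTwo [] = refl
sum-oneTwo (one∷ ot) = sum-oneTwo ot
sum-oneTwo (two∷ ot) = cong suc (sum-oneTwo ot)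

count-partWeights-∷ : ∀ {k} r rs (c : Fin k → ℕ) → count (partWeights (r ∷ rs)) noPins c ≡
  ∑[ i < k ] (if suc r ≤ᵇ c i then count (partWeights rs) noPins (lower c i (suc r)) else 0)
count-partWeights-∷ r rs c = count-∷ (suc r) (partWeights rs) noPins c

count-∷-vanishes : ∀ {k} r rs (c : Fin k → ℕ) → (∀ i → suc r ≤ c i → count (partWeights rs) noPins (lower c i (suc r)) ≡ 0) →
  count (partWeights (r ∷ rs)) noPins c ≡ 0
count-∷-vanishes {k} r rs c vanish = trans (count-partWeights-∷ r rs c) (trans (sum-cong-≗ term≡0) (∑-zero k))
  where
  term≡0 : ∀ i → (if suc r ≤ᵇ c i then count (partWeights rs) noPins (lower c i (suc r)) else 0) ≡ 0
  term≡0 i with suc r ≤ᵇ c i in fits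
  ... | false = refl
  ... | true = vanish i (≤ᵇ⇒≤ (suc r) (c i) (subst T (sym fits) tt))

count-not-oneTwo : ∀ {k} rs (c : Fin k → ℕ) → (∀ x → c x ≤ 2) → ¬ OneTwo rs → count (partWeights rs) noPins c ≡ 0
count-not-oneTwo [] c c≤2 ¬ot = ⊥-elim (¬ot [])
count-not-oneTwo (zero ∷ rs) c c≤2 ¬ot = count-∷-vanishes 0 rs c λ i _ →
  count-not-oneTwo rs _ (λ x → ≤-trans (lower-≤ c i 1 x) (c≤2 x)) (λ ot → ¬ot (one∷ ot))
count-not-oneTwo (suc zero ∷ rs) c c≤2 ¬ot = count-∷-vanishes 1 rs c λ i _ →
  count-not-oneTwo rs _ (λ x → ≤-trans (lower-≤ c i 2 x) (c≤2 x)) (λ ot → ¬ot (two∷ ot))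
count-not-oneTwo (suc (suc r) ∷ rs) c c≤2 ¬ot = count-∷-vanishes (2 + r) rs c λ i 3+r≤cᵢ →
  ⊥-elim (3+r≰2 (≤-trans 3+r≤cᵢ (c≤2 i)))
  where
  3+r≰2 : ¬ 3 + r ≤ 2
  3+r≰2 (s≤s (s≤s ()))

-- 2^t times the number of maps from the parts of 1^z 2^o to a monomial with
-- t squares: the parts 2 go injectively to squares (t P′ o ways) and the
-- parts 1 fill the remaining places (z! / 2^(t-o) ways).

powerCount : ℕ → ℕ → ℕ → ℕ
powerCount t o z = (t P′ o) * 2 ^ o * z !

P′-pred : ∀ t o → t * ((t ∸ 1) P′ o) ≡ (t ∸ o) * (t P′ o)
P′-pred t zero = refl
P′-pred t (suc o) = begin
  t * ((t ∸ 1 ∸ o) * ((t ∸ 1) P′ o))       ≡⟨ swap t (t ∸ 1 ∸ o) _ ⟩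
  (t ∸ 1 ∸ o) * (t * ((t ∸ 1) P′ o))       ≡⟨ cong₂ _*_ (∸-+-assoc t 1 o) (P′-pred t o) ⟩
  (t ∸ suc o) * ((t ∸ o) * (t P′ o))       ∎
  where
  open ≡-Reasoning
  swap : ∀ a b c → a * (b * c) ≡ b * (a * c)
  swap = solve-∀

P′-vanish : ∀ t o → t ≤ o → t P′ suc o ≡ 0
P′-vanish t o t≤o = cong (_* (t P′ o)) (m≤n⇒m∸n≡0 t≤o)

powerCount-vanish : ∀ t o → t < o → ∀ z → powerCount t o z ≡ 0
powerCount-vanish t (suc o) (s≤s t≤o) z rewrite P′-vanish t o t≤o = refl

powerCount-part₂ : ∀ t o z → t * (2 * powerCount (t ∸ 1) o z) ≡ powerCount t (suc o) z
powerCount-part₂ t o z = begin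
  t * (2 * (((t ∸ 1) P′ o) * 2 ^ o * z !))   ≡⟨ regroup t ((t ∸ 1) P′ o) (2 ^ o) (z !) ⟩
  t * ((t ∸ 1) P′ o) * (2 * 2 ^ o) * z !     ≡⟨ cong (λ q → q * (2 * 2 ^ o) * z !) (P′-pred t o) ⟩
  (t ∸ o) * (t P′ o) * (2 * 2 ^ o) * z !   ∎
  where
  open ≡-Reasoning
  regroup : ∀ t q p f → t * (2 * (q * p * f)) ≡ t * q * (2 * p) * f
  regroup = solve-∀

powerCount-part₁ : ∀ s t o z → s + 2 * t ≡ suc (z + 2 * o) →
  s * powerCount t o z + t * (2 * powerCount (t ∸ 1) o z) ≡ powerCount t o (suc z)
powerCount-part₁ s t o z balance with o ≤? t
... | no o≰t = vanishing (≰⇒> o≰t)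
  where
  vanishing : t < o → s * powerCount t o z + t * (2 * powerCount (t ∸ 1) o z) ≡ powerCount t o (suc z)
  vanishing t<o rewrite powerCount-vanish t o t<o z | powerCount-vanish (t ∸ 1) o (≤-<-trans (m∸n≤m t 1) t<o) z
                      | powerCount-vanish t o t<o (suc z) =
    cong₂ _+_ (*-zeroʳ s) (trans (cong (t *_) (*-zeroʳ 2)) (*-zeroʳ t))
... | yes o≤t = begin
  s * powerCount t o z + t * (2 * powerCount (t ∸ 1) o z)     ≡⟨ cong (s * powerCount t o z +_) (powerCount-part₂ t o z) ⟩
  s * ((t P′ o) * 2 ^ o * z !) + (t ∸ o) * (t P′ o) * (2 * 2 ^ o) * z !
                                                              ≡⟨ regroup s (t ∸ o) (t P′ o) (2 ^ o) (z !) ⟩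
  (t P′ o) * 2 ^ o * ((s + 2 * (t ∸ o)) * z !)                 ≡⟨ cong (λ q → (t P′ o) * 2 ^ o * (q * z !)) s+2[t-o]≡1+z ⟩
  (t P′ o) * 2 ^ o * (suc z * z !)                               ∎
  where
  open ≡-Reasoning
  regroup : ∀ s d q p f → s * (q * p * f) + d * q * (2 * p) * f ≡ q * p * ((s + 2 * d) * f)
  regroup = solve-∀
  rearrange : ∀ s o d → s + 2 * (o + d) ≡ s + 2 * d + 2 * o
  rearrange = solve-∀
  s+2[t-o]≡1+z : s + 2 * (t ∸ o) ≡ suc z
  s+2[t-o]≡1+z = +-cancelʳ-≡ (2 * o) _ _ (trans (sym (rearrange s o (t ∸ o))) (trans (cong (λ q → s + 2 * q) (m+[n∸m]≡n o≤t)) balance))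

singles twos : ∀ {k} → (Fin k → ℕ) → ℕ
singles {k} c = ∑[ i < k ] 𝟙 (c i ≡ᵇ 1)
twos {k} c = ∑[ i < k ] 𝟙 (c i ≡ᵇ 2)

∑-by-multiplicity : ∀ {k} (c : Fin k → ℕ) → (∀ x → c x ≤ 2) → sum c ≡ singles c + 2 * twos c
∑-by-multiplicity c c≤2 = trans (sum-cong-≗ split)
  (trans (∑-distrib-+ (λ i → 𝟙 (c i ≡ᵇ 1)) (λ i → 2 * 𝟙 (c i ≡ᵇ 2))) (cong (singles c +_) (∑-*ˡ 2 (λ i → 𝟙 (c i ≡ᵇ 2)))))
  where
  split : ∀ i → c i ≡ 𝟙 (c i ≡ᵇ 1) + 2 * 𝟙 (c i ≡ᵇ 2)
  split i with c i | c≤2 i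
  ... | 0 | _ = refl
  ... | 1 | _ = refl
  ... | 2 | _ = refl
  ... | suc (suc (suc _)) | s≤s (s≤s ())

∑-by-value : ∀ {k} (c : Fin k → ℕ) X Y → ∑[ i < k ] (𝟙 (c i ≡ᵇ 1) * X + 𝟙 (c i ≡ᵇ 2) * Y) ≡ singles c * X + twos c * Y
∑-by-value c X Y = trans (∑-distrib-+ (λ i → 𝟙 (c i ≡ᵇ 1) * X) (λ i → 𝟙 (c i ≡ᵇ 2) * Y))
  (cong₂ _+_ (∑-*ʳ X (λ i → 𝟙 (c i ≡ᵇ 1))) (∑-*ʳ Y (λ i → 𝟙 (c i ≡ᵇ 2))))

twos-lower : ∀ {k} (c : Fin k → ℕ) i a → twos c + 𝟙 ((c i ∸ a) ≡ᵇ 2) ≡ twos (lower c i a) + 𝟙 (c i ≡ᵇ 2)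
twos-lower c i a = subst (λ x → twos c + 𝟙 (x ≡ᵇ 2) ≡ twos (lower c i a) + 𝟙 (c i ≡ᵇ 2)) (lower-self c i a)
  (∑-update (λ j → 𝟙 (c j ≡ᵇ 2)) (λ j → 𝟙 (lower c i a j ≡ᵇ 2)) i
    (λ j j≢i → cong (λ x → 𝟙 (x ≡ᵇ 2)) (sym (lower-other c i a j j≢i))))

CountFormula : List ℕ → Set
CountFormula rs = ∀ {k} (c : Fin k → ℕ) → (∀ x → c x ≤ 2) → sum c ≡ mult₁ rs + 2 * mult₂ rs →
  2 ^ twos c * count (partWeights rs) noPins c ≡ powerCount (twos c) (mult₂ rs) (mult₁ rs)

module _ {rs} (formula : CountFormula rs) {k} (c : Fin k → ℕ) (c≤2 : ∀ x → c x ≤ 2) (i : Fin k) where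

  private
    lower≤2 : ∀ a x → lower c i a x ≤ 2
    lower≤2 a x = ≤-trans (lower-≤ c i a x) (c≤2 x)

  lowered-single : c i ≡ 1 → sum (lower c i 1) ≡ mult₁ rs + 2 * mult₂ rs →
    2 ^ twos c * count (partWeights rs) noPins (lower c i 1) ≡ powerCount (twos c) (mult₂ rs) (mult₁ rs)
  lowered-single cᵢ≡1 total = begin
    2 ^ twos c * count (partWeights rs) noPins (lower c i 1)          ≡⟨ cong (λ t → 2 ^ t * count (partWeights rs) noPins (lower c i 1)) same-twos ⟩
    2 ^ twos (lower c i 1) * count (partWeights rs) noPins (lower c i 1) ≡⟨ formula (lower c i 1) (lower≤2 1) total ⟩
    powerCount (twos (lower c i 1)) (mult₂ rs) (mult₁ rs)              ≡⟨ cong (λ t → powerCount t (mult₂ rs) (mult₁ rs)) same-twos ⟨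
    powerCount (twos c) (mult₂ rs) (mult₁ rs)                          ∎
    where
    open ≡-Reasoning
    same-twos : twos c ≡ twos (lower c i 1)
    same-twos = +-cancelʳ-≡ 0 _ _ (subst (λ v → twos c + 𝟙 ((v ∸ 1) ≡ᵇ 2) ≡ twos (lower c i 1) + 𝟙 (v ≡ᵇ 2)) cᵢ≡1 (twos-lower c i 1))

  -- The side condition holds for a = 1 and a = 2: the lowered entry is no longer a square.
  lowered-double : ∀ a → c i ≡ 2 → 𝟙 ((2 ∸ a) ≡ᵇ 2) ≡ 0 → sum (lower c i a) ≡ mult₁ rs + 2 * mult₂ rs →
    2 ^ twos c * count (partWeights rs) noPins (lower c i a) ≡ 2 * powerCount (twos c ∸ 1) (mult₂ rs) (mult₁ rs)
  lowered-double a cᵢ≡2 unsquared total = begin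
    2 ^ twos c * count (partWeights rs) noPins (lower c i a)               ≡⟨ cong (λ t → 2 ^ t * count (partWeights rs) noPins (lower c i a)) one-fewer ⟩
    2 * 2 ^ twos (lower c i a) * count (partWeights rs) noPins (lower c i a) ≡⟨ *-assoc 2 (2 ^ twos (lower c i a)) _ ⟩
    2 * (2 ^ twos (lower c i a) * count (partWeights rs) noPins (lower c i a)) ≡⟨ cong (2 *_) (formula (lower c i a) (lower≤2 a) total) ⟩
    2 * powerCount (twos (lower c i a)) (mult₂ rs) (mult₁ rs)              ≡⟨ cong (λ t → 2 * powerCount (t ∸ 1) (mult₂ rs) (mult₁ rs)) one-fewer ⟨
    2 * powerCount (twos c ∸ 1) (mult₂ rs) (mult₁ rs)                      ∎
    where
    open ≡-Reasoning
    one-fewer : twos c ≡ suc (twos (lower c i a))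
    one-fewer = begin
      twos c                                      ≡⟨ +-identityʳ _ ⟨
      twos c + 0                                  ≡⟨ cong (twos c +_) unsquared ⟨
      twos c + 𝟙 ((2 ∸ a) ≡ᵇ 2)
          ≡⟨ subst (λ v → twos c + 𝟙 ((v ∸ a) ≡ᵇ 2) ≡ twos (lower c i a) + 𝟙 (v ≡ᵇ 2)) cᵢ≡2 (twos-lower c i a) ⟩
      twos (lower c i a) + 1                      ≡⟨ +-comm _ 1 ⟩
      suc (twos (lower c i a))                    ∎

formula-[] : CountFormula []
formula-[] {k} c c≤2 total = cong₂ (λ t b → 2 ^ t * b) no-twos (T⇒𝟙≡1 (Equivalence.from (T-∧ {contentᵇ c [] []}) (empty , tt)))
  where
  c≡0 = ∑≡0⇒≡0 c total
  no-twos : twos c ≡ 0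
  no-twos = trans (sum-cong-≗ (λ i → cong (λ x → 𝟙 (x ≡ᵇ 2)) (c≡0 i))) (∑-zero k)
  empty : T (contentᵇ c [] [])
  empty = contentᵇ⁺ c [] [] (λ x → sym (c≡0 x))

formula-one∷ : ∀ {rs} → CountFormula rs → CountFormula (0 ∷ rs)
formula-one∷ {rs} formula {k} c c≤2 total = begin
  2 ^ t * count (partWeights (0 ∷ rs)) noPins c     ≡⟨ cong (2 ^ t *_) (count-partWeights-∷ 0 rs c) ⟩
  2 ^ t * ∑[ i < k ] term i                         ≡⟨ ∑-*ˡ (2 ^ t) term ⟨
  ∑[ i < k ] (2 ^ t * term i)                       ≡⟨ sum-cong-≗ per-colour ⟩
  ∑[ i < k ] (𝟙 (c i ≡ᵇ 1) * powerCount t o z + 𝟙 (c i ≡ᵇ 2) * (2 * powerCount (t ∸ 1) o z))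
                                                    ≡⟨ ∑-by-value c (powerCount t o z) (2 * powerCount (t ∸ 1) o z) ⟩
  singles c * powerCount t o z + t * (2 * powerCount (t ∸ 1) o z)
                                                    ≡⟨ powerCount-part₁ (singles c) t o z (trans (sym (∑-by-multiplicity c c≤2)) total) ⟩
  powerCount t o (suc z)                            ∎
  where
  open ≡-Reasoning
  t = twos c
  o = mult₂ rs
  z = mult₁ rs
  term : Fin k → ℕ
  term i = if 1 ≤ᵇ c i then count (partWeights rs) noPins (lower c i 1) else 0
  per-colour : ∀ i → 2 ^ t * term i ≡ 𝟙 (c i ≡ᵇ 1) * powerCount t o z + 𝟙 (c i ≡ᵇ 2) * (2 * powerCount (t ∸ 1) o z)
  per-colour i with c i in cᵢ | c≤2 i
  ... | 0 | _ = *-zeroʳ (2 ^ t)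
  ... | 1 | _ = trans (lowered-single {rs} formula c c≤2 i cᵢ (∑-lower-≡ c i 1 (≤-reflexive (sym cᵢ)) total))
                      (sym (trans (+-identityʳ _) (+-identityʳ _)))
  ... | 2 | _ = trans (lowered-double {rs} formula c c≤2 i 1 cᵢ refl (∑-lower-≡ c i 1 (≤-trans (s≤s z≤n) (≤-reflexive (sym cᵢ))) total))
                      (sym (+-identityʳ _))
  ... | suc (suc (suc _)) | s≤s (s≤s ())

formula-two∷ : ∀ {rs} → CountFormula rs → CountFormula (1 ∷ rs)
formula-two∷ {rs} formula {k} c c≤2 total = begin
  2 ^ t * count (partWeights (1 ∷ rs)) noPins c     ≡⟨ cong (2 ^ t *_) (count-partWeights-∷ 1 rs c) ⟩
  2 ^ t * ∑[ i < k ] term i                         ≡⟨ ∑-*ˡ (2 ^ t) term ⟨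
  ∑[ i < k ] (2 ^ t * term i)                       ≡⟨ sum-cong-≗ per-colour ⟩
  ∑[ i < k ] (𝟙 (c i ≡ᵇ 1) * 0 + 𝟙 (c i ≡ᵇ 2) * (2 * powerCount (t ∸ 1) o z))
                                                    ≡⟨ ∑-by-value c 0 (2 * powerCount (t ∸ 1) o z) ⟩
  singles c * 0 + t * (2 * powerCount (t ∸ 1) o z)  ≡⟨ cong (_+ t * (2 * powerCount (t ∸ 1) o z)) (*-zeroʳ (singles c)) ⟩
  t * (2 * powerCount (t ∸ 1) o z)                  ≡⟨ powerCount-part₂ t o z ⟩
  powerCount t (suc o) z                            ∎
  where
  open ≡-Reasoning
  t = twos c
  o = mult₂ rs
  z = mult₁ rs
  term : Fin k → ℕ
  term i = if 2 ≤ᵇ c i then count (partWeights rs) noPins (lower c i 2) else 0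
  total′ : sum c ≡ 2 + (z + 2 * o)
  total′ = trans total (regroup z o)
    where
    regroup : ∀ z o → z + 2 * suc o ≡ 2 + (z + 2 * o)
    regroup = solve-∀
  per-colour : ∀ i → 2 ^ t * term i ≡ 𝟙 (c i ≡ᵇ 1) * 0 + 𝟙 (c i ≡ᵇ 2) * (2 * powerCount (t ∸ 1) o z)
  per-colour i with c i in cᵢ | c≤2 i
  ... | 0 | _ = *-zeroʳ (2 ^ t)
  ... | 1 | _ = *-zeroʳ (2 ^ t)
  ... | 2 | _ = trans (lowered-double {rs} formula c c≤2 i 2 cᵢ refl (∑-lower-≡ c i 2 (≤-reflexive (sym cᵢ)) total′))
                      (sym (+-identityʳ _))
  ... | suc (suc (suc _)) | s≤s (s≤s ())

count-oneTwo : ∀ {rs} → OneTwo rs → CountFormula rs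
count-oneTwo [] = formula-[]
count-oneTwo {0 ∷ rs} (one∷ ot) = formula-one∷ {rs} (count-oneTwo ot)
count-oneTwo {1 ∷ rs} (two∷ ot) = formula-two∷ {rs} (count-oneTwo ot)

powerCount-relation : ∀ o z → o ≢ 2 → powerCount 0 o z + powerCount 2 o z ≡ 2 * powerCount 1 o z
powerCount-relation 0 z _ = rel₀ (z !)
  where
  rel₀ : ∀ f → 1 * 1 * f + 1 * 1 * f ≡ 2 * (1 * 1 * f)
  rel₀ = solve-∀
powerCount-relation 1 z _ = rel₁ (z !)
  where
  rel₁ : ∀ f → 0 * 2 * f + 2 * 2 * f ≡ 2 * (1 * 2 * f)
  rel₁ = solve-∀
powerCount-relation 2 z o≢2 = ⊥-elim (o≢2 refl)
powerCount-relation (suc (suc (suc o))) z _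
  rewrite powerCount-vanish 0 (3 + o) (s≤s z≤n) z | powerCount-vanish 1 (3 + o) (s≤s (s≤s z≤n)) z
        | powerCount-vanish 2 (3 + o) (s≤s (s≤s (s≤s z≤n))) z = refl

twos-lookup-ones : ∀ r → twos (List.lookup (replicate r 1)) ≡ 0
twos-lookup-ones zero = refl
twos-lookup-ones (suc r) = twos-lookup-ones r

≤2-lookup-ones : ∀ r x → List.lookup (replicate r 1) x ≤ 2
≤2-lookup-ones r x = ≤-trans (≤-reflexive (lookup-ones r x)) (s≤s z≤n)

module _ (N : ℕ) (4≤N : 4 ≤ N) where

  private
    c₀ = List.lookup (mono₀ N)
    c₁ = List.lookup (mono₁ N)
    c₂ = List.lookup (mono₂ N)
    2≤N = ≤-trans (s≤s (s≤s z≤n)) 4≤N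

    c₀≤2 : ∀ x → c₀ x ≤ 2
    c₀≤2 = ≤2-lookup-ones N
    c₁≤2 : ∀ x → c₁ x ≤ 2
    c₁≤2 zero = ≤-refl
    c₁≤2 (suc x) = ≤2-lookup-ones (N ∸ 2) x
    c₂≤2 : ∀ x → c₂ x ≤ 2
    c₂≤2 zero = ≤-refl
    c₂≤2 (suc zero) = ≤-refl
    c₂≤2 (suc (suc x)) = ≤2-lookup-ones (N ∸ 4) x

  #mono₀ #mono₁ #mono₂ : List ℕ → ℕ
  #mono₀ rs = count (partWeights rs) noPins c₀
  #mono₁ rs = count (partWeights rs) noPins c₁
  #mono₂ rs = count (partWeights rs) noPins c₂

  power-sum-relation : ∀ rs → (OneTwo rs × mult₂ rs ≡ 2) ⊎ (#mono₀ rs + 4 * #mono₂ rs ≡ 4 * #mono₁ rs)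
  power-sum-relation rs with oneTwo? rs
  ... | no ¬ot rewrite count-not-oneTwo rs c₀ c₀≤2 ¬ot | count-not-oneTwo rs c₁ c₁≤2 ¬ot | count-not-oneTwo rs c₂ c₂≤2 ¬ot = inj₂ refl
  ... | yes ot with Vec.sum (partWeights rs) ℕ.≟ N
  ...   | no deg≢N rewrite count-wrong-degree (partWeights rs) noPins c₀ (λ eq → deg≢N (sym (trans (sym (∑-mono₀ N)) eq)))
                         | count-wrong-degree (partWeights rs) noPins c₁ (λ eq → deg≢N (sym (trans (sym (∑-mono₁ N 2≤N)) eq)))
                         | count-wrong-degree (partWeights rs) noPins c₂ (λ eq → deg≢N (sym (trans (sym (∑-mono₂ N 4≤N)) eq))) = inj₂ refl
  ...   | yes deg≡N with mult₂ rs ℕ.≟ 2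
  ...     | yes m₂≡2 = inj₁ (ot , m₂≡2)
  ...     | no m₂≢2 = inj₂ (begin
    #mono₀ rs + 4 * #mono₂ rs                     ≡⟨ cong (_+ 4 * #mono₂ rs) (sym (*-identityˡ (#mono₀ rs))) ⟩
    1 * #mono₀ rs + 4 * #mono₂ rs                 ≡⟨ cong₂ _+_ (formula c₀ 0 c₀≤2 (∑-mono₀ N) (twos-lookup-ones N))
                                                               (formula c₂ 2 c₂≤2 (∑-mono₂ N 4≤N) (cong (2 +_) (twos-lookup-ones (N ∸ 4)))) ⟩
    powerCount 0 o z + powerCount 2 o z           ≡⟨ powerCount-relation o z m₂≢2 ⟩
    2 * powerCount 1 o z                          ≡⟨ cong (2 *_) (formula c₁ 1 c₁≤2 (∑-mono₁ N 2≤N) (cong (1 +_) (twos-lookup-ones (N ∸ 2)))) ⟨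
    2 * (2 * #mono₁ rs)                           ≡⟨ *-assoc 2 2 (#mono₁ rs) ⟨
    4 * #mono₁ rs                                 ∎)
    where
    open ≡-Reasoning
    o = mult₂ rs
    z = mult₁ rs
    formula : ∀ {k} (c : Fin k → ℕ) t → (∀ x → c x ≤ 2) → sum c ≡ N → twos c ≡ t →
      2 ^ t * count (partWeights rs) noPins c ≡ powerCount t o z
    formula c t c≤2 sum≡N refl = count-oneTwo ot c c≤2 (trans sum≡N (trans (sym deg≡N) (degree-oneTwo ot)))

-- ℕtoℚ a is by definition the normalisation of the unnormalised a / 1

private
  ιᵘ : ℕ → ℚᵘ
  ιᵘ a = mkℚᵘ (ℤ.+ a) 0

  toℚᵘ-ℕtoℚ : ∀ a → toℚᵘ (ℕtoℚ a) ℚᵘ.≃ ιᵘ a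
  toℚᵘ-ℕtoℚ a = ℚ.toℚᵘ-fromℚᵘ (ιᵘ a)

ℕtoℚ-+ : ∀ a b → ℕtoℚ (a + b) ≡ ℕtoℚ a ℚ.+ ℕtoℚ b
ℕtoℚ-+ a b = ℚ.toℚᵘ-injective (begin
  toℚᵘ (ℕtoℚ (a + b))                 ≈⟨ toℚᵘ-ℕtoℚ (a + b) ⟩
  ιᵘ (a + b)                           ≈⟨ *≡* (trans (cong (ℤ._* ℤ.+ 1) (ℤ.pos-+ a b)) (clear-denominators (ℤ.+ a) (ℤ.+ b))) ⟩
  ιᵘ a ℚᵘ.+ ιᵘ b                         ≈⟨ ℚᵘ.+-cong (toℚᵘ-ℕtoℚ a) (toℚᵘ-ℕtoℚ b) ⟨
  toℚᵘ (ℕtoℚ a) ℚᵘ.+ toℚᵘ (ℕtoℚ b)       ≈⟨ ℚ.toℚᵘ-homo-+ (ℕtoℚ a) (ℕtoℚ b) ⟨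
  toℚᵘ (ℕtoℚ a ℚ.+ ℕtoℚ b)                 ∎)
  where
  open SetoidReasoning ℚᵘ.≃-setoid
  clear-denominators : ∀ x y → (x ℤ.+ y) ℤ.* ℤ.+ 1 ≡ (x ℤ.* ℤ.+ 1 ℤ.+ y ℤ.* ℤ.+ 1) ℤ.* ℤ.+ 1
  clear-denominators = ℤ-solve-∀

ℕtoℚ-* : ∀ a b → ℕtoℚ (a * b) ≡ ℕtoℚ a ℚ.* ℕtoℚ b
ℕtoℚ-* a b = ℚ.toℚᵘ-injective (begin
  toℚᵘ (ℕtoℚ (a * b))                 ≈⟨ toℚᵘ-ℕtoℚ (a * b) ⟩
  ιᵘ (a * b)                           ≈⟨ *≡* (cong (ℤ._* ℤ.+ 1) (ℤ.pos-* a b)) ⟩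
  ιᵘ a ℚᵘ.* ιᵘ b                         ≈⟨ ℚᵘ.*-cong (toℚᵘ-ℕtoℚ a) (toℚᵘ-ℕtoℚ b) ⟨
  toℚᵘ (ℕtoℚ a) ℚᵘ.* toℚᵘ (ℕtoℚ b)       ≈⟨ ℚ.toℚᵘ-homo-* (ℕtoℚ a) (ℕtoℚ b) ⟨
  toℚᵘ (ℕtoℚ a ℚ.* ℕtoℚ b)                 ∎)
  where open SetoidReasoning ℚᵘ.≃-setoid

ℕtoℚ-injective : ∀ {a b} → ℕtoℚ a ≡ ℕtoℚ b → a ≡ b
ℕtoℚ-injective {a} {b} eq with ℚᵘ.≃-trans (ℚᵘ.≃-sym (toℚᵘ-ℕtoℚ a)) (ℚᵘ.≃-trans (ℚᵘ.≃-reflexive (cong toℚᵘ eq)) (toℚᵘ-ℕtoℚ b))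
... | *≡* a*1≡b*1 = ℤ.+-injective (trans (sym (ℤ.*-identityʳ (ℤ.+ a))) (trans a*1≡b*1 (ℤ.*-identityʳ (ℤ.+ b))))

-- The functional L

module _ (N : ℕ) where

  four : ℚ
  four = ℕtoℚ 4

  L : SymFun → ℚ
  L f = f (mono₀ N) ℚ.+ four ℚ.* f (mono₂ N) ℚ.- four ℚ.* f (mono₁ N)

  L-ℕ : ∀ {a b c p} → a + 4 * c ≡ 4 * b + p → ℕtoℚ a ℚ.+ four ℚ.* ℕtoℚ c ℚ.- four ℚ.* ℕtoℚ b ≡ ℕtoℚ p
  L-ℕ {a} {b} {c} {p} rel = begin
    ℕtoℚ a ℚ.+ four ℚ.* ℕtoℚ c ℚ.- four ℚ.* ℕtoℚ b             ≡⟨ cong (λ q → ℕtoℚ a ℚ.+ q ℚ.- four ℚ.* ℕtoℚ b) (ℕtoℚ-* 4 c) ⟨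
    ℕtoℚ a ℚ.+ ℕtoℚ (4 * c) ℚ.- four ℚ.* ℕtoℚ b            ≡⟨ cong (ℚ._- four ℚ.* ℕtoℚ b) (ℕtoℚ-+ a (4 * c)) ⟨
    ℕtoℚ (a + 4 * c) ℚ.- four ℚ.* ℕtoℚ b               ≡⟨ cong₂ (λ x y → ℕtoℚ x ℚ.- y) rel (sym (ℕtoℚ-* 4 b)) ⟩
    ℕtoℚ (4 * b + p) ℚ.- ℕtoℚ (4 * b)              ≡⟨ cong (ℚ._- ℕtoℚ (4 * b)) (ℕtoℚ-+ (4 * b) p) ⟩
    ℕtoℚ (4 * b) ℚ.+ ℕtoℚ p ℚ.- ℕtoℚ (4 * b)           ≡⟨ solve 2 (λ x y → x :+ y :- x := y) refl (ℕtoℚ (4 * b)) (ℕtoℚ p) ⟩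
    ℕtoℚ p                                              ∎
    where open ≡-Reasoning

  L-cong : ∀ {f g : SymFun} → (∀ α → f α ≡ g α) → L f ≡ L g
  L-cong f≗g = cong₂ ℚ._-_ (cong₂ ℚ._+_ (f≗g (mono₀ N)) (cong (four ℚ.*_) (f≗g (mono₂ N)))) (cong (four ℚ.*_) (f≗g (mono₁ N)))

  L-pProd : 4 ≤ N → ∀ rs → (OneTwo rs × mult₂ rs ≡ 2) ⊎ L (pProd rs) ≡ 0ℚ
  L-pProd 4≤N rs = map₂ vanishing (power-sum-relation N 4≤N rs)
    where
    vanishing : #mono₀ N 4≤N rs + 4 * #mono₂ N 4≤N rs ≡ 4 * #mono₁ N 4≤N rs → L (pProd rs) ≡ 0ℚ
    vanishing rel = trans (L-cong (pProd≡count rs))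
      (L-ℕ {#mono₀ N 4≤N rs} {#mono₁ N 4≤N rs} {#mono₂ N 4≤N rs} {0} (trans rel (sym (+-identityʳ (4 * #mono₁ N 4≤N rs)))))

  ∑L : LinComb → ℚ
  ∑L = foldr (λ c acc → proj₁ c ℚ.* L (pProd (proj₂ c)) ℚ.+ acc) 0ℚ

  L-evalP : ∀ cs → L (evalP cs) ≡ ∑L cs
  L-evalP [] = solve 1 (λ f → con 0ℚ :+ f :* con 0ℚ :- f :* con 0ℚ := con 0ℚ) refl four
  L-evalP ((a , rs) ∷ cs) = trans
    (linear a (pProd rs (mono₀ N)) (pProd rs (mono₁ N)) (pProd rs (mono₂ N)) (evalP cs (mono₀ N)) (evalP cs (mono₁ N)) (evalP cs (mono₂ N)))
    (cong (λ q → a ℚ.* L (pProd rs) ℚ.+ q) (L-evalP cs))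
    where
    linear : ∀ a p₀ p₁ p₂ e₀ e₁ e₂ → (a ℚ.* p₀ ℚ.+ e₀) ℚ.+ four ℚ.* (a ℚ.* p₂ ℚ.+ e₂) ℚ.- four ℚ.* (a ℚ.* p₁ ℚ.+ e₁) ≡ a ℚ.* (p₀ ℚ.+ four ℚ.* p₂ ℚ.- four ℚ.* p₁) ℚ.+ (e₀ ℚ.+ four ℚ.* e₂ ℚ.- four ℚ.* e₁)
    linear a p₀ p₁ p₂ e₀ e₁ e₂ = solve 8 (λ a p₀ p₁ p₂ e₀ e₁ e₂ f →
      (a :* p₀ :+ e₀) :+ f :* (a :* p₂ :+ e₂) :- f :* (a :* p₁ :+ e₁) := a :* (p₀ :+ f :* p₂ :- f :* p₁) :+ (e₀ :+ f :* e₂ :- f :* e₁))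
      refl a p₀ p₁ p₂ e₀ e₁ e₂ four

  module _ (4≤N : 4 ≤ N) where

    L-ω-term : ∀ rs a → (signω rs ℚ.* a) ℚ.* L (pProd rs) ≡ a ℚ.* L (pProd rs)
    L-ω-term rs a = by-cases (L-pProd 4≤N rs)
      where
      by-cases : (OneTwo rs × mult₂ rs ≡ 2) ⊎ L (pProd rs) ≡ 0ℚ → (signω rs ℚ.* a) ℚ.* L (pProd rs) ≡ a ℚ.* L (pProd rs)
      by-cases (inj₂ L≡0) = trans (cong ((signω rs ℚ.* a) ℚ.*_) L≡0) (trans (ℚ.*-zeroʳ (signω rs ℚ.* a)) (sym (trans (cong (a ℚ.*_) L≡0) (ℚ.*-zeroʳ a))))
      by-cases (inj₁ (ot , m₂≡2)) = cong (ℚ._* L (pProd rs)) (trans (cong (λ s → (if isEven s then 1ℚ else ℚ.- 1ℚ) ℚ.* a) (trans (sum-oneTwo ot) m₂≡2)) (ℚ.*-identityˡ a))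

    L-ω : ∀ cs → L (evalP (ωLin cs)) ≡ L (evalP cs)
    L-ω cs = trans (L-evalP (ωLin cs)) (trans (termwise cs) (sym (L-evalP cs)))
      where
      termwise : ∀ cs → ∑L (ωLin cs) ≡ ∑L cs
      termwise [] = refl
      termwise ((a , rs) ∷ cs) = cong₂ ℚ._+_ (L-ω-term rs a) (termwise cs)

    oneTwo-head : ∀ {r rs} → OneTwo (r ∷ rs) → r ≤ 1 × OneTwo rs
    oneTwo-head (one∷ ot) = z≤n , ot
    oneTwo-head (two∷ ot) = s≤s z≤n , ot

    no-twos-in-oddParts : ∀ μ → OneTwo (oddParts μ) → mult₂ (oddParts μ) ≡ 0
    no-twos-in-oddParts [] _ = refl
    no-twos-in-oddParts (zero ∷ μ) ot = no-twos-in-oddParts μ (proj₂ (oneTwo-head ot))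
    no-twos-in-oddParts (suc m ∷ μ) ot with oneTwo-head ot
    ... | s≤s m+1+m≤0 , _ = ⊥-elim (n≮0 (subst (_≤ 0) (+-suc m m) m+1+m≤0))

    L-Γ : ∀ ds → L (evalP (map (λ d → proj₁ d , oddParts (proj₂ d)) ds)) ≡ 0ℚ
    L-Γ ds = trans (L-evalP (map (λ d → proj₁ d , oddParts (proj₂ d)) ds)) (vanish ds)
      where
      vanish : ∀ ds → ∑L (map (λ d → proj₁ d , oddParts (proj₂ d)) ds) ≡ 0ℚ
      vanish [] = refl
      vanish ((a , μ) ∷ ds) = trans (cong₂ ℚ._+_ (trans (cong (a ℚ.*_) L≡0) (ℚ.*-zeroʳ a)) (vanish ds)) (ℚ.+-identityʳ 0ℚ)
        where
        L≡0 : L (pProd (oddParts μ)) ≡ 0ℚ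
        L≡0 = [ (λ (ot , m₂≡2) → ⊥-elim (0≢1+n (trans (sym (no-twos-in-oddParts μ ot)) m₂≡2))) , (λ L≡0 → L≡0) ]′ (L-pProd 4≤N (oddParts μ))

  L-Yfrom : ∀ f cs → L (Yfrom f cs) ≡ (L f ℚ.+ L (evalP (ωLin cs))) ℚ.* ½
  L-Yfrom f cs = solve 8 (λ f₀ f₁ f₂ w₀ w₁ w₂ h q →
      (f₀ :+ w₀) :* h :+ q :* ((f₂ :+ w₂) :* h) :- q :* ((f₁ :+ w₁) :* h) := ((f₀ :+ q :* f₂ :- q :* f₁) :+ (w₀ :+ q :* w₂ :- q :* w₁)) :* h)
    refl (f (mono₀ N)) (f (mono₁ N)) (f (mono₂ N)) (ω (mono₀ N)) (ω (mono₁ N)) (ω (mono₂ N)) ½ four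
    where ω = evalP (ωLin cs)

  half-double : ∀ x → (x ℚ.+ x) ℚ.* ½ ≡ x
  half-double x = trans (solve 2 (λ x h → (x :+ x) :* h := x :* (h :+ h)) refl x ½) (ℚ.*-identityʳ x)

  L-vanishes : 4 ≤ N → ∀ f cs → IsPExpansion f cs → InΓ (Yfrom f cs) → L f ≡ 0ℚ
  L-vanishes 4≤N f cs expansion (ds , odd-expansion) = begin
    L f                                              ≡⟨ half-double (L f) ⟨
    (L f ℚ.+ L f) ℚ.* ½                                  ≡⟨ cong (λ q → (L f ℚ.+ q) ℚ.* ½) (trans (L-cong expansion) (sym (L-ω 4≤N cs))) ⟩
    (L f ℚ.+ L (evalP (ωLin cs))) ℚ.* ½                  ≡⟨ L-Yfrom f cs ⟨
    L (Yfrom f cs)                                   ≡⟨ L-cong odd-expansion ⟩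
    L (evalP (map (λ d → proj₁ d , oddParts (proj₂ d)) ds)) ≡⟨ L-Γ 4≤N ds ⟩
    0ℚ                                               ∎
    where open ≡-Reasoning

-- Connected graphs any two of whose edges meet

↔-injective : ∀ {m n} (φ : Fin m ↔ Fin n) {x y} → Inverse.to φ x ≡ Inverse.to φ y → x ≡ y
↔-injective φ {x} {y} eq = trans (sym (Inverse.strictlyInverseʳ φ x)) (trans (cong (Inverse.from φ) eq) (Inverse.strictlyInverseʳ φ y))

centring : ∀ {n} (a : Fin n) → ∃[ k ] Σ (Fin n ↔ Fin (suc k)) (λ φ → Inverse.to φ a ≡ zero)
centring {suc k} a = k , transpose a zero , sends-a
  where
  sends-a : PC.transpose a zero a ≡ zero
  sends-a with a ≟ a
  ... | yes _ = refl
  ... | no a≢a = ⊥-elim (a≢a refl)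

module _ (G : Graph) where

  private
    A = adj G

  adjacent-sym : ∀ {u v} → A u v ≡ true → A v u ≡ true
  adjacent-sym {u} {v} e = trans (Graph.sym G v u) e

  star-iso : ∀ {k} (φ : Fin (n G) ↔ Fin (suc k)) {a} → Inverse.to φ a ≡ zero →
    (∀ u v → A u v ≡ true → u ≡ a ⊎ v ≡ a) → (∀ w → w ≢ a → A a w ≡ true) → G ≅ Star k
  star-iso φ {a} φa≡0 touch-a a-adjacent = φ , λ u v → by-image u v (to u) refl (to v) refl
    where
    to = Inverse.to φ
    centre : ∀ {x} → to x ≡ zero → x ≡ a
    centre φx≡0 = ↔-injective φ (trans φx≡0 (sym φa≡0))
    leaf : ∀ {x i} → to x ≡ suc i → x ≢ a
    leaf φx≡suc refl with trans (sym φa≡0) φx≡suc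
    ... | ()
    by-image : ∀ u v x → to u ≡ x → ∀ y → to v ≡ y → A u v ≡ starAdj x y
    by-image u v zero φu y φv with centre φu
    by-image u v zero φu zero φv | refl with centre φv
    ... | refl = irrefl G u
    by-image u v zero φu (suc _) φv | refl = a-adjacent v (leaf φv)
    by-image u v (suc _) φu zero φv with centre φv
    ... | refl = trans (Graph.sym G u v) (a-adjacent u (leaf φu))
    by-image u v (suc _) φu (suc _) φv with A u v in edge
    ... | false = refl
    ... | true with touch-a u v edge
    ...   | inj₁ u≡a = ⊥-elim (leaf φu u≡a)
    ...   | inj₂ v≡a = ⊥-elim (leaf φv v≡a)

  complete-iso : (φ : Fin (n G) ↔ Fin 3) → (∀ u v → A u v ≡ not (does (u ≟ v))) → G ≅ C3
  complete-iso φ complete = φ , λ u v → trans (complete u v) (cong not (same-decision u v))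
    where
    same-decision : ∀ u v → does (u ≟ v) ≡ does (Inverse.to φ u ≟ Inverse.to φ v)
    same-decision u v with u ≟ v | Inverse.to φ u ≟ Inverse.to φ v
    ... | yes _ | yes _ = refl
    ... | yes refl | no φu≢φv = ⊥-elim (φu≢φv refl)
    ... | no u≢v | yes φu≡φv = ⊥-elim (u≢v (↔-injective φ φu≡φv))
    ... | no _ | no _ = refl

three-elements : ∀ {n} {a b c : Fin n} → a ≢ b → a ≢ c → b ≢ c → (∀ x → x ≡ a ⊎ x ≡ b ⊎ x ≡ c) → Fin n ↔ Fin 3
three-elements {n} {a} {b} {c} a≢b a≢c b≢c cover = mk↔ₛ′ index element index-element element-index
  where
  index : Fin n → Fin 3
  index x with x ≟ a | x ≟ b
  ... | yes _ | _ = zero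
  ... | no _ | yes _ = suc zero
  ... | no _ | no _ = suc (suc zero)
  element : Fin 3 → Fin n
  element zero = a
  element (suc zero) = b
  element (suc (suc zero)) = c
  index-element : ∀ i → index (element i) ≡ i
  index-element zero with a ≟ a
  ... | yes _ = refl
  ... | no a≢a = ⊥-elim (a≢a refl)
  index-element (suc zero) with b ≟ a | b ≟ b
  ... | yes b≡a | _ = ⊥-elim (a≢b (sym b≡a))
  ... | no _ | yes _ = refl
  ... | no _ | no b≢b = ⊥-elim (b≢b refl)
  index-element (suc (suc zero)) with c ≟ a | c ≟ b
  ... | yes c≡a | _ = ⊥-elim (a≢c (sym c≡a))
  ... | no _ | yes c≡b = ⊥-elim (b≢c (sym c≡b))
  ... | no _ | no _ = refl
  element-index : ∀ x → element (index x) ≡ x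
  element-index x with x ≟ a | x ≟ b | cover x
  ... | yes x≡a | _ | _ = sym x≡a
  ... | no _ | yes x≡b | _ = sym x≡b
  ... | no x≢a | no _ | inj₁ x≡a = ⊥-elim (x≢a x≡a)
  ... | no _ | no x≢b | inj₂ (inj₁ x≡b) = ⊥-elim (x≢b x≡b)
  ... | no _ | no _ | inj₂ (inj₂ x≡c) = sym x≡c

module _ (G : Graph) (no-disjoint : ¬ HasDisjointEdges G) where

  private
    A = adj G
    V = Fin (n G)

  edges-meet : ∀ {x y p q} → A x y ≡ true → A p q ≡ true → x ≢ p → x ≢ q → y ≡ p ⊎ y ≡ q
  edges-meet {x} {y} {p} {q} exy epq x≢p x≢q with y ≟ p | y ≟ q
  ... | yes y≡p | _ = inj₁ y≡p
  ... | no _ | yes y≡q = inj₂ y≡q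
  ... | no y≢p | no y≢q = ⊥-elim (no-disjoint (x , y , p , q , exy , epq , adjacent⇒≢ G exy , x≢p , x≢q , y≢p , y≢q , adjacent⇒≢ G epq))

  first-edge : ∀ {x y} → Walk G x y → x ≢ y → ∃[ z ] A x z ≡ true
  first-edge here x≢x = ⊥-elim (x≢x refl)
  first-edge (step {v = z} e _) _ = z , e

  module _ (connected : Connected G) where

    star-centred : ∀ a → (∀ u v → A u v ≡ true → u ≡ a ⊎ v ≡ a) → ∃[ k ] (G ≅ Star k)
    star-centred a touch-a with centring a
    ... | k , φ , φa≡0 = k , star-iso G φ φa≡0 touch-a a-adjacent
      where
      a-adjacent : ∀ w → w ≢ a → A a w ≡ true
      a-adjacent w w≢a with first-edge (proj₂ connected w a) w≢a
      ... | z , e with touch-a w z e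
      ...   | inj₁ w≡a = ⊥-elim (w≢a w≡a)
      ...   | inj₂ refl = adjacent-sym G e

    another-neighbour : ∀ {p q x y} → A q p ≡ true → A x y ≡ true → x ≢ p → y ≢ p → ∃[ w ] (A q w ≡ true × w ≢ p × w ≢ q)
    another-neighbour {p} {q} {x} {y} eqp exy x≢p y≢p with x ≟ q
    ... | yes refl = y , exy , y≢p , (λ y≡x → adjacent⇒≢ G exy (sym y≡x))
    ... | no x≢q with edges-meet exy (adjacent-sym G eqp) x≢p x≢q
    ...   | inj₁ y≡p = ⊥-elim (y≢p y≡p)
    ...   | inj₂ refl = x , adjacent-sym G exy , x≢p , x≢q

    triangle : ∀ {a b c} → A a b ≡ true → A b c ≡ true → A a c ≡ true → G ≅ C3
    triangle {a} {b} {c} eab ebc eac = complete-iso G (three-elements a≢b a≢c b≢c cover) complete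
      where
      a≢b = adjacent⇒≢ G eab
      b≢c = adjacent⇒≢ G ebc
      a≢c = adjacent⇒≢ G eac
      cover : ∀ x → x ≡ a ⊎ x ≡ b ⊎ x ≡ c
      cover x with x ≟ a | x ≟ b | x ≟ c
      ... | yes x≡a | _ | _ = inj₁ x≡a
      ... | no _ | yes x≡b | _ = inj₂ (inj₁ x≡b)
      ... | no _ | no _ | yes x≡c = inj₂ (inj₂ x≡c)
      ... | no x≢a | no x≢b | no x≢c with first-edge (proj₂ connected x a) x≢a
      ...   | y , exy with edges-meet exy eab x≢a x≢b | edges-meet exy ebc x≢b x≢c | edges-meet exy eac x≢a x≢c
      ...     | inj₁ refl | inj₁ y≡b | _ = ⊥-elim (a≢b y≡b)
      ...     | inj₁ refl | inj₂ y≡c | _ = ⊥-elim (a≢c y≡c)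
      ...     | inj₂ refl | _ | inj₁ y≡a = ⊥-elim (a≢b (sym y≡a))
      ...     | inj₂ refl | _ | inj₂ y≡c = ⊥-elim (b≢c y≡c)
      adjacent-distinct : ∀ u v → u ≢ v → A u v ≡ true
      adjacent-distinct u v u≢v with cover u | cover v
      ... | inj₁ refl | inj₁ refl = ⊥-elim (u≢v refl)
      ... | inj₁ refl | inj₂ (inj₁ refl) = eab
      ... | inj₁ refl | inj₂ (inj₂ refl) = eac
      ... | inj₂ (inj₁ refl) | inj₁ refl = adjacent-sym G eab
      ... | inj₂ (inj₁ refl) | inj₂ (inj₁ refl) = ⊥-elim (u≢v refl)
      ... | inj₂ (inj₁ refl) | inj₂ (inj₂ refl) = ebc
      ... | inj₂ (inj₂ refl) | inj₁ refl = adjacent-sym G eac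
      ... | inj₂ (inj₂ refl) | inj₂ (inj₁ refl) = adjacent-sym G ebc
      ... | inj₂ (inj₂ refl) | inj₂ (inj₂ refl) = ⊥-elim (u≢v refl)
      complete : ∀ u v → A u v ≡ not (does (u ≟ v))
      complete u v with u ≟ v
      ... | yes refl = irrefl G u
      ... | no u≢v = adjacent-distinct u v u≢v

    -- Two edges missing a and b respectively force a common neighbour of a and b.
    common-neighbour : ∀ {a b c d e f} → A a b ≡ true → A c d ≡ true → c ≢ a → d ≢ a →
      A e f ≡ true → e ≢ b → f ≢ b → G ≅ C3
    common-neighbour {a} {b} eab ecd c≢a d≢a eef e≢b f≢b
      with another-neighbour (adjacent-sym G eab) ecd c≢a d≢a | another-neighbour eab eef e≢b f≢b
    ... | w , ebw , w≢a , w≢b | w′ , eaw′ , w′≢b , w′≢a with w ≟ w′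
    ...   | yes refl = triangle eab ebw eaw′
    ...   | no w≢w′ = ⊥-elim (no-disjoint (a , w′ , b , w , eaw′ , ebw ,
              (λ a≡w′ → w′≢a (sym a≡w′)) , adjacent⇒≢ G eab , (λ a≡w → w≢a (sym a≡w)) ,
              w′≢b , (λ w′≡w → w≢w′ (sym w′≡w)) , (λ b≡w → w≢b (sym b≡w))))

    private
      EdgeAvoiding : V → Set
      EdgeAvoiding a = ∃[ u ] ∃[ v ] (A u v ≡ true × u ≢ a × v ≢ a)

      edgeAvoiding? : ∀ a → Dec (EdgeAvoiding a)
      edgeAvoiding? a = any? λ u → any? λ v → (A u v ≟𝔹 true) ×-dec (¬? (u ≟ a) ×-dec ¬? (v ≟ a))

      touching : ∀ {a} → ¬ EdgeAvoiding a → ∀ u v → A u v ≡ true → u ≡ a ⊎ v ≡ a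
      touching {a} none u v e with u ≟ a | v ≟ a
      ... | yes u≡a | _ = inj₁ u≡a
      ... | no _ | yes v≡a = inj₂ v≡a
      ... | no u≢a | no v≢a = ⊥-elim (none (u , v , e , u≢a , v≢a))

    classification : (G ≅ C3) ⊎ ∃[ k ] (G ≅ Star k)
    classification with any? (λ u → any? (λ v → A u v ≟𝔹 true))
    ... | no edgeless = inj₂ (star-centred (proj₁ connected) λ u v e → ⊥-elim (edgeless (u , v , e)))
    ... | yes (a , b , eab) with edgeAvoiding? a
    ...   | no avoid-a = inj₂ (star-centred a (touching avoid-a))
    ...   | yes (c , d , ecd , c≢a , d≢a) with edgeAvoiding? b
    ...     | no avoid-b = inj₂ (star-centred b (touching avoid-b))
    ...     | yes (e , f , eef , e≢b , f≢b) = inj₁ (common-neighbour eab ecd c≢a d≢a eef e≢b f≢b)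

no-disjoint-edges : (G : Graph) → YInΓ G → ¬ HasDisjointEdges G
no-disjoint-edges G (cs , expansion , inΓ) (v₁ , v₂ , v₃ , v₄ , e₁₂ , e₃₄ , _ , v₁≢v₃ , v₁≢v₄ , v₂≢v₃ , v₂≢v₄ , _) =
  contradiction
  where
  N = n G
  4≤n = 4≤order G e₁₂ e₃₄ v₁≢v₃ v₁≢v₄ v₂≢v₃ v₂≢v₄
  L[X]≡P : L N (X G) ≡ ℕtoℚ (twoMonoEdges G)
  L[X]≡P = trans (L-cong N (X≡properCount G)) (L-ℕ N {properCount G (mono₀ N)} {properCount G (mono₁ N)} {properCount G (mono₂ N)}
    (coefficient-relation G e₁₂ e₃₄ v₁≢v₃ v₁≢v₄ v₂≢v₃ v₂≢v₄))
  P≡0 : twoMonoEdges G ≡ 0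
  P≡0 = ℕtoℚ-injective (trans (sym L[X]≡P) (L-vanishes N 4≤n (X G) cs expansion inΓ))
  contradiction : ⊥
  contradiction = n≮0 (subst (1 ≤_) P≡0 (≤-trans (1≤n! (N ∸ 4)) (twoMonoEdges-≥ G e₁₂ e₃₄ v₁≢v₃ v₁≢v₄ v₂≢v₃ v₂≢v₄)))

lemma3p6 : (G : Graph) → YInΓ G →
    (¬ HasDisjointEdges G) × (Connected G → (G ≅ C3) ⊎ (∃[ k ] (G ≅ Star k)))
lemma3p6 G Y∈Γ = no-disjoint-edges G Y∈Γ , classification G (no-disjoint-edges G Y∈Γ)
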